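{- Let $G$ be a connected $k$-regular simple graph with $k\geq 2$ and $|V(G)|\geq 4$, and let $n\geq 3$ be an integer. Then \[ \lambda_3(G\times T_n)=\begin{cases}\min\{n^2\lambda_2(G),\,3nk-6\}, & \text{if } g(G)=3;\\ \min\{n^2\lambda_2(G),\,3nk-4\}, & \text{if } g(G)\geq 4.\end{cases} \]
   Context: The total graph $T_n$ is obtained from the complete graph $K_n$ by attaching a loop at every vertex. The direct product $G\times H$ has vertex set $V(G)\times V(H)$, with $(u_1,v_1)$ adjacent to $(u_2,v_2)$ iff $u_1u_2\in E(G)$ and $v_1v_2\in E(H)$ (for $H=T_n$, $v_1v_2\in E(H)$ holds for all $v_1,v_2$, including $v_1=v_2$, because of the loops). For a graph $X$ and integer $j\ge 1$, an edge set $S\subseteq E(X)$ is a $j$-restricted edge-cut if $X-S$ is disconnected and every component of $X-S$ has at least $j$ vertices; $\lambda_j(X)$ is the minimum size of a $j$-restricted edge-cut, or $+\infty$ if none exists. $g(G)$ denotes the girth of $G$. -}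

module Defs where

open import Data.Nat using (ℕ; _*_; _+_; _<ᵇ_)
open import Data.Fin using (Fin; toℕ; remQuot)
open import Data.Bool using (Bool; true; false; _∧_; not; if_then_else_)
open import Data.List using (List; allFin; map)
open import Data.Nat.ListAction using (sum)
open import Data.Product using (Σ; ∃; _×_; _,_; proj₁; proj₂)
open import Data.Maybe using (Maybe; just; nothing)
open import Data.Nat using (_≤_)
open import Relation.Binary.PropositionalEquality using (_≡_)
open import Relation.Nullary using (¬_)
open import Function.Definitions using (Injective)

-- A finite graph on vertex set Fin V, given by a Boolean adjacency
-- function (loops allowed in general; simplicity is a separate predicate).
record Graph : Set where
  field
    V   : ℕ
    adj : Fin V → Fin V → Bool
open Graph public

IsSimple : Graph → Set
IsSimple G = (∀ u v → adj G u v ≡ adj G v u) × (∀ u → adj G u u ≡ false)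

count : ∀ {m} → (Fin m → Bool) → ℕ
count {m} p = sum (map (λ i → if p i then 1 else 0) (allFin m))

degree : (G : Graph) → Fin (V G) → ℕ
degree G v = count (λ u → adj G v u)

IsRegular : Graph → ℕ → Set
IsRegular G k = ∀ v → degree G v ≡ k

data Reach {m : ℕ} (E : Fin m → Fin m → Bool) : Fin m → Fin m → Set where
  here : ∀ {u} → Reach E u u
  step : ∀ {u v w} → E u v ≡ true → Reach E v w → Reach E u w

ConnectedRel : ∀ {m} → (Fin m → Fin m → Bool) → Set
ConnectedRel {m} E = ∀ (u v : Fin m) → Reach E u v

IsConnected : Graph → Set
IsConnected G = ConnectedRel (adj G)

HasTriangle : Graph → Set
HasTriangle G = Σ (Fin (V G)) λ u → Σ (Fin (V G)) λ v → Σ (Fin (V G)) λ w →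
  (adj G u v ≡ true) × (adj G v w ≡ true) × (adj G w u ≡ true)

Girth3 : Graph → Set
Girth3 G = HasTriangle G

-- girth(G) ≥ 4 (no cycle of length 3; G simple so no cycles of length ≤ 2)
GirthAtLeast4 : Graph → Set
GirthAtLeast4 G = ¬ HasTriangle G

Total : ℕ → Graph
Total n = record { V = n ; adj = λ _ _ → true }

-- direct product G × H, vertex (u,v) encoded via remQuot on Fin (V G * V H)
_×ᵍ_ : Graph → Graph → Graph
G ×ᵍ H = record
  { V = V G * V H
  ; adj = λ x y → adj G (proj₁ (remQuot {V G} (V H) x)) (proj₁ (remQuot {V G} (V H) y))
                 ∧ adj H (proj₂ (remQuot {V G} (V H) x)) (proj₂ (remQuot {V G} (V H) y)) }

record EdgeSet (X : Graph) : Set where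
  field
    mem    : Fin (V X) → Fin (V X) → Bool
    symm   : ∀ u v → mem u v ≡ mem v u
    subset : ∀ u v → mem u v ≡ true → adj X u v ≡ true
open EdgeSet public

-- number of edges in S (each unordered edge {u,v}, u ≠ v, counted once)
size : ∀ {X} → EdgeSet X → ℕ
size {X} S = sum (map (λ u → count (λ v → mem S u v ∧ (toℕ u <ᵇ toℕ v))) (allFin (V X)))

minus : (X : Graph) → EdgeSet X → Fin (V X) → Fin (V X) → Bool
minus X S u v = adj X u v ∧ not (mem S u v)

-- S is a j-restricted edge-cut: X - S disconnected and every component
-- (the set of vertices reachable from a vertex v) has at least j vertices.
IsRestrictedCut : (X : Graph) → ℕ → EdgeSet X → Set
IsRestrictedCut X j S =
  (¬ ConnectedRel (minus X S)) ×
  (∀ (v : Fin (V X)) → Σ (Fin j → Fin (V X)) λ f →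
      Injective _≡_ _≡_ f × (∀ i → Reach (minus X S) v (f i)))

-- λ_j(X) = r, where r = just c (minimum size c) or nothing (= +∞, no
-- j-restricted edge-cut exists).
LambdaIs : (X : Graph) → ℕ → Maybe ℕ → Set
LambdaIs X j nothing  = ∀ (S : EdgeSet X) → ¬ IsRestrictedCut X j S
LambdaIs X j (just c) =
  (Σ (EdgeSet X) λ S → IsRestrictedCut X j S × size S ≡ c) ×
  (∀ (S : EdgeSet X) → IsRestrictedCut X j S → c ≤ size S)

{-# OPTIONS --safe #-}
-- For a vertex set B of X = G × Tₙ let a(u) be the size of its fibre over u ∈ V(G).
-- Since (u, b) ~ (v, c) in X exactly when u ~ v in G, twice the size of the cut of B is
-- Σ_{u~v} cross(a u, a v) with cross(x, y) = x(n − y) + (n − x)y, and k-regularity gives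
-- Σ_{u~v} (cross(a u, a v) + 2 a(u) a(v)) = 2kn Σ_u a(u).
--
-- Upper bounds: lifting a minimum 2-restricted cut of G to every layer gives n²λ₂(G) edges, and
-- cutting off three vertices t₀ ~ t₁ ~ t₂ of one layer gives 3nk − e edges, where e, the number
-- of arcs (ordered adjacent pairs) among them, is 6 for a triangle and 4 for an induced path;
-- when g(G) ≥ 4 no three vertices span more than 4 arcs.
--
-- Lower bound: let S be a 3-restricted cut and B a union of components of X − S, so that
-- cut(B) ⊆ S. If B has a full and an empty fibre, every level set {u | a(u) > θ}, θ < n, is a
-- proper vertex set of G whose cut is 2-restricted unless some vertex has all k neighbours
-- across; summing over θ gives |S| ≥ n² min(λ₂(G), k). Otherwise, complementing B if necessary,
-- no fibre of B is full: if three fibres are nonempty the identity above gives |S| ≥ 3nk − e,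
-- and if B lies over an edge of G (with at least three vertices) a direct count gives
-- |S| ≥ 3nk − 4. As n²k ≥ 3nk, this is min(n²λ₂(G), 3nk − e) in every case.
module Submission where

open import Defs
open import Data.Bool using (Bool; true; false; _∧_; not; _xor_; if_then_else_)
open import Data.Bool.Properties using (xor-comm; xor-same; ∧-identityʳ; ∧-zeroʳ) renaming (_≟_ to _≟ᴮ_)
open import Data.Empty using (⊥-elim)
open import Data.Fin using (Fin; zero; suc; toℕ; combine; remQuot; inject≤; fromℕ<; _↑ˡ_; _↑ʳ_)
import Data.Fin as Fin
open import Data.Fin.Patterns using (0F; 1F; 2F)
open import Data.Fin.Properties
  using (_≟_; suc-injective; toℕ-injective; toℕ<n; any?; all?; ¬∀⟶∃¬; remQuot-combine; combine-remQuot; inject≤-injective)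
open import Data.List using (tabulate; map; allFin)
open import Data.List.Properties using (map-tabulate)
open import Data.Maybe using (Maybe; just; nothing; maybe)
open import Data.Nat using (ℕ; zero; suc; _+_; _*_; _∸_; _⊓_; _≤_; _<_; _<ᵇ_; _≤?_; _<?_; z≤n; s≤s; s≤s⁻¹)
import Data.Nat.ListAction as ListAction
open import Data.Nat.Properties hiding (_≟_; suc-injective)
open import Data.Nat.Properties using () renaming (_≟_ to _≟ℕ_)
open import Data.Nat.Tactic.RingSolver using (solve-∀)
open import Algebra.Properties.Semiring.Sum +-*-semiring
  using (sum; sum-syntax; sum-cong-≗; ∑-distrib-+; ∑-comm; *-distribˡ-sum; *-distribʳ-sum)
open import Data.Product using (Σ; ∃; _×_; _,_; proj₁; proj₂)
open import Data.Sum using (_⊎_; inj₁; inj₂)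
open import Data.Vec.Functional using (Vector; _∷_; [])
open import Function using (_∘_; id)
open import Function.Definitions using (Injective)
open import Relation.Binary.Definitions using (tri<; tri≈; tri>)
open import Relation.Binary.PropositionalEquality
open import Relation.Nullary using (Dec; yes; no; does; ¬_; ¬?)
open import Relation.Nullary.Decidable
  using (dec-true; dec-false; decidable-stable; _×-dec_; _⊎-dec_; ¬¬-excluded-middle)
open import Relation.Nullary.Negation using (¬¬-map)
open import Relation.Unary using (Decidable)

-- Indicators and finite sums

⟦_⟧ : Bool → ℕ
⟦ b ⟧ = if b then 1 else 0

⟦⟧≤1 : ∀ b → ⟦ b ⟧ ≤ 1
⟦⟧≤1 true  = ≤-refl
⟦⟧≤1 false = z≤n

⟦∧⟧ : ∀ a b → ⟦ a ∧ b ⟧ ≡ ⟦ a ⟧ * ⟦ b ⟧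
⟦∧⟧ true  b = sym (*-identityˡ ⟦ b ⟧)
⟦∧⟧ false b = refl

⟦⟧*-cong : ∀ b {x y} → (b ≡ true → x ≡ y) → ⟦ b ⟧ * x ≡ ⟦ b ⟧ * y
⟦⟧*-cong true  x≡y = cong (1 *_) (x≡y refl)
⟦⟧*-cong false _   = refl

⟦⟧*-mono : ∀ b {x y} → (b ≡ true → x ≤ y) → ⟦ b ⟧ * x ≤ ⟦ b ⟧ * y
⟦⟧*-mono true  x≤y = *-monoʳ-≤ 1 (x≤y refl)
⟦⟧*-mono false _   = z≤n

∧-true-left : ∀ {a b} → a ∧ b ≡ true → a ≡ true
∧-true-left {true} _ = refl

<ᵇ-true : ∀ {a b} → a < b → (a <ᵇ b) ≡ true
<ᵇ-true {zero}  {suc b} _       = refl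
<ᵇ-true {suc a} {suc b} (s≤s p) = <ᵇ-true p

<ᵇ-false : ∀ {a b} → b ≤ a → (a <ᵇ b) ≡ false
<ᵇ-false {a}     {zero}  _       = refl
<ᵇ-false {suc a} {suc b} (s≤s p) = <ᵇ-false p

sum-tabulate : ∀ {m} (f : Fin m → ℕ) → ListAction.sum (tabulate f) ≡ sum f
sum-tabulate {zero}  f = refl
sum-tabulate {suc m} f = cong (f zero +_) (sum-tabulate (f ∘ suc))

sum-map-allFin : ∀ {m} (f : Fin m → ℕ) → ListAction.sum (map f (allFin m)) ≡ sum f
sum-map-allFin {m} f = trans (cong ListAction.sum (map-tabulate {n = m} id f)) (sum-tabulate f)

count≡∑ : ∀ {m} (p : Fin m → Bool) → count p ≡ ∑[ i < m ] ⟦ p i ⟧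
count≡∑ p = sum-map-allFin (λ i → ⟦ p i ⟧)

∑-mono-≤ : ∀ {m} {f g : Vector ℕ m} → (∀ i → f i ≤ g i) → sum f ≤ sum g
∑-mono-≤ {zero}  f≤g = z≤n
∑-mono-≤ {suc m} f≤g = +-mono-≤ (f≤g zero) (∑-mono-≤ (f≤g ∘ suc))

∑-const : ∀ m c → ∑[ i < m ] c ≡ m * c
∑-const zero    c = refl
∑-const (suc m) c = cong (c +_) (∑-const m c)

∑-zero : ∀ m → ∑[ i < m ] 0 ≡ 0
∑-zero m = trans (∑-const m 0) (*-zeroʳ m)

≤-∑ : ∀ {m} (f : Vector ℕ m) i → f i ≤ sum f
≤-∑ f zero    = m≤m+n (f zero) _
≤-∑ f (suc i) = ≤-trans (≤-∑ (f ∘ suc) i) (m≤n+m _ (f zero))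

∑-↑ : ∀ a b (f : Vector ℕ (a + b)) → sum f ≡ ∑[ i < a ] f (i ↑ˡ b) + ∑[ j < b ] f (a ↑ʳ j)
∑-↑ zero    b f = refl
∑-↑ (suc a) b f = trans (cong (f zero +_) (∑-↑ a b (f ∘ suc))) (sym (+-assoc (f zero) _ _))

∑-combine : ∀ m n (f : Vector ℕ (m * n)) → sum f ≡ ∑[ u < m ] ∑[ b < n ] f (combine u b)
∑-combine zero    n f = refl
∑-combine (suc m) n f = trans (∑-↑ n (m * n) f) (cong (∑[ b < n ] f (b ↑ˡ (m * n)) +_) (∑-combine m n (f ∘ (n ↑ʳ_))))

∑∑ : ∀ {m} → (Fin m → Fin m → ℕ) → ℕ
∑∑ {m} g = ∑[ u < m ] ∑[ v < m ] g u v

∑∑-distrib-+ : ∀ {m} (f g : Fin m → Fin m → ℕ) → ∑∑ (λ u v → f u v + g u v) ≡ ∑∑ f + ∑∑ g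
∑∑-distrib-+ {m} f g = trans (sum-cong-≗ λ u → ∑-distrib-+ (f u) (g u)) (∑-distrib-+ (λ u → sum (f u)) (λ u → sum (g u)))

count>0⇒∃ : ∀ {m} (p : Fin m → Bool) → 0 < ∑[ i < m ] ⟦ p i ⟧ → ∃ λ i → p i ≡ true
count>0⇒∃ {suc m} p 0<c with p zero in p₀
... | true  = zero , p₀
... | false = let (i , pᵢ) = count>0⇒∃ (p ∘ suc) 0<c in suc i , pᵢ

count>1⇒∃₂ : ∀ {m} (p : Fin m → Bool) → 1 < ∑[ i < m ] ⟦ p i ⟧ →
             ∃ λ i → ∃ λ i′ → i ≢ i′ × p i ≡ true × p i′ ≡ true
count>1⇒∃₂ {suc m} p 1<c with p zero in p₀
... | true  = let (i′ , pᵢ′) = count>0⇒∃ (p ∘ suc) (s≤s⁻¹ 1<c) in zero , suc i′ , (λ ()) , p₀ , pᵢ′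
... | false = let (i , i′ , i≢i′ , pᵢ , pᵢ′) = count>1⇒∃₂ (p ∘ suc) 1<c in
              suc i , suc i′ , (λ eq → i≢i′ (suc-injective eq)) , pᵢ , pᵢ′

count+count-not : ∀ {m} (p : Fin m → Bool) → ∑[ i < m ] ⟦ p i ⟧ + ∑[ i < m ] ⟦ not (p i) ⟧ ≡ m
count+count-not {zero}  p = refl
count+count-not {suc m} p with p zero | count+count-not (p ∘ suc)
... | true  | eq = cong suc eq
... | false | eq = trans (+-suc _ _) (cong suc eq)

count-not : ∀ {m} (p : Fin m → Bool) → ∑[ i < m ] ⟦ not (p i) ⟧ ≡ m ∸ ∑[ i < m ] ⟦ p i ⟧
count-not {m} p = trans (sym (m+n∸m≡n P (∑[ i < m ] ⟦ not (p i) ⟧))) (cong (_∸ P) (count+count-not p))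
  where
  P : ℕ
  P = ∑[ i < m ] ⟦ p i ⟧

δ : ∀ {m} → Fin m → Fin m → ℕ
δ i j = ⟦ does (i ≟ j) ⟧

δ-≡ : ∀ {m} {i j : Fin m} → i ≡ j → δ i j ≡ 1
δ-≡ {i = i} {j} i≡j = cong ⟦_⟧ (dec-true (i ≟ j) i≡j)

δ-≢ : ∀ {m} {i j : Fin m} → i ≢ j → δ i j ≡ 0
δ-≢ {i = i} {j} i≢j = cong ⟦_⟧ (dec-false (i ≟ j) i≢j)

∑-δ : ∀ {m} (i : Fin m) (g : Vector ℕ m) → ∑[ j < m ] (δ i j * g j) ≡ g i
∑-δ {suc m} zero    g = trans (cong₂ _+_ (+-identityʳ (g zero)) (∑-zero m)) (+-identityʳ (g zero))
∑-δ {suc m} (suc i) g = ∑-δ i (g ∘ suc)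

∑-δˡ : ∀ {m} (i : Fin m) → ∑[ j < m ] δ j i ≡ 1
∑-δˡ {suc m} zero    = cong suc (∑-zero m)
∑-δˡ {suc m} (suc i) = ∑-δˡ i

∑∑-row+col≤ : ∀ {m} (g : Fin m → Fin m → ℕ) u → g u u ≡ 0 → ∑[ y < m ] g u y + ∑[ x < m ] g x u ≤ ∑∑ g
∑∑-row+col≤ {m} g u guu = begin
  ∑[ y < m ] g u y + ∑[ x < m ] g x u                   ≡⟨ cong (_+ ∑[ x < m ] g x u) (∑-δ u (λ x → ∑[ y < m ] g x y)) ⟨
  ∑[ x < m ] (δ u x * ∑[ y < m ] g x y) + ∑[ x < m ] g x u ≡⟨ ∑-distrib-+ (λ x → δ u x * ∑[ y < m ] g x y) (λ x → g x u) ⟨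
  ∑[ x < m ] (δ u x * ∑[ y < m ] g x y + g x u)         ≤⟨ ∑-mono-≤ row-or-column ⟩
  ∑∑ g                                                  ∎
  where
  open ≤-Reasoning
  row-or-column : ∀ x → δ u x * ∑[ y < m ] g x y + g x u ≤ ∑[ y < m ] g x y
  row-or-column x with u ≟ x
  ... | yes refl = ≤-reflexive (trans (cong₂ _+_ (*-identityˡ _) guu) (+-identityʳ _))
  ... | no  _    = ≤-∑ (g x) u

-- Sums over the image of an injection

module _ {j m : ℕ} (t : Fin j → Fin m) where

  image? : Decidable (λ v → ∃ λ i → t i ≡ v)
  image? v = any? (λ i → t i ≟ v)

  ⟦image⟧-at : ∀ i → ⟦ does (image? (t i)) ⟧ ≡ 1
  ⟦image⟧-at i = cong ⟦_⟧ (dec-true (image? (t i)) (i , refl))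

module _ {j m : ℕ} {t : Fin j → Fin m} (t-inj : Injective _≡_ _≡_ t) where

  δ-injective : ∀ i i′ → δ (t i) (t i′) ≡ δ i i′
  δ-injective i i′ with i ≟ i′
  ... | yes i≡i′ = δ-≡ (cong t i≡i′)
  ... | no  i≢i′ = δ-≢ (i≢i′ ∘ t-inj)

  ⟦image⟧≡∑δ : ∀ v → ⟦ does (image? t v) ⟧ ≡ ∑[ i < j ] δ (t i) v
  ⟦image⟧≡∑δ v with image? t v
  ... | yes (i₀ , refl) = sym (trans (sum-cong-≗ (λ i → δ-injective i i₀)) (∑-δˡ i₀))
  ... | no  v∉t         = sym (trans (sum-cong-≗ (λ i → δ-≢ (λ t≡v → v∉t (i , t≡v)))) (∑-zero j))

  ∑-image : ∀ (g : Vector ℕ m) → ∑[ v < m ] (⟦ does (image? t v) ⟧ * g v) ≡ ∑[ i < j ] g (t i)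
  ∑-image g = begin
    ∑[ v < m ] (⟦ does (image? t v) ⟧ * g v)      ≡⟨ sum-cong-≗ (λ v → cong (_* g v) (⟦image⟧≡∑δ v)) ⟩
    ∑[ v < m ] (∑[ i < j ] δ (t i) v * g v)      ≡⟨ sum-cong-≗ (λ v → *-distribʳ-sum (g v) (λ i → δ (t i) v)) ⟩
    ∑[ v < m ] ∑[ i < j ] (δ (t i) v * g v)      ≡⟨ ∑-comm (λ v i → δ (t i) v * g v) ⟩
    ∑[ i < j ] ∑[ v < m ] (δ (t i) v * g v)      ≡⟨ sum-cong-≗ (λ i → ∑-δ (t i) g) ⟩
    ∑[ i < j ] g (t i)                           ∎
    where open ≡-Reasoning

  ∑-supported : ∀ (f : Vector ℕ m) → (∀ v → ¬ (∃ λ i → t i ≡ v) → f v ≡ 0) →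
                sum f ≡ ∑[ i < j ] f (t i)
  ∑-supported f f-supp = trans (sum-cong-≗ restrict) (∑-image f)
    where
    restrict : ∀ v → f v ≡ ⟦ does (image? t v) ⟧ * f v
    restrict v with image? t v
    ... | yes _   = sym (*-identityˡ (f v))
    ... | no  v∉t = f-supp v v∉t

  ∑-⟦image⟧ : ∑[ v < m ] ⟦ does (image? t v) ⟧ ≡ j
  ∑-⟦image⟧ = begin
    ∑[ v < m ] ⟦ does (image? t v) ⟧        ≡⟨ sum-cong-≗ (λ v → *-identityʳ ⟦ does (image? t v) ⟧) ⟨
    ∑[ v < m ] (⟦ does (image? t v) ⟧ * 1)  ≡⟨ ∑-image (λ _ → 1) ⟩
    ∑[ i < j ] 1                            ≡⟨ trans (∑-const j 1) (*-identityʳ j) ⟩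
    j                                       ∎
    where open ≡-Reasoning

  injective⇒≤count : ∀ (p : Fin m → Bool) → (∀ i → p (t i) ≡ true) → j ≤ ∑[ v < m ] ⟦ p v ⟧
  injective⇒≤count p p-t = begin
    j                                 ≡⟨ ∑-⟦image⟧ ⟨
    ∑[ v < m ] ⟦ does (image? t v) ⟧  ≤⟨ ∑-mono-≤ image≤p ⟩
    ∑[ v < m ] ⟦ p v ⟧                ∎
    where
    open ≤-Reasoning
    image≤p : ∀ v → ⟦ does (image? t v) ⟧ ≤ ⟦ p v ⟧
    image≤p v with image? t v
    ... | yes (i , refl) = ≤-reflexive (cong ⟦_⟧ (sym (p-t i)))
    ... | no  _          = z≤n

injective-[] : ∀ {m} → Injective _≡_ _≡_ ([] {A = Fin m})
injective-[] {x = ()}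

injective-∷ : ∀ {j m} {x : Fin m} {t : Fin j → Fin m} →
              (∀ i → x ≢ t i) → Injective _≡_ _≡_ t → Injective _≡_ _≡_ (x ∷ t)
injective-∷ x∉t t-inj {zero}  {zero}  _   = refl
injective-∷ x∉t t-inj {zero}  {suc i} x≡t = ⊥-elim (x∉t i x≡t)
injective-∷ x∉t t-inj {suc i} {zero}  t≡x = ⊥-elim (x∉t i (sym t≡x))
injective-∷ x∉t t-inj {suc i} {suc i′} eq = cong suc (t-inj eq)

pair-injective : ∀ {m} {u v : Fin m} → u ≢ v → Injective _≡_ _≡_ (u ∷ v ∷ [])
pair-injective u≢v = injective-∷ (λ { 0F → u≢v }) (injective-∷ (λ ()) injective-[])

triple-injective : ∀ {m} {u v w : Fin m} → u ≢ v → u ≢ w → v ≢ w → Injective _≡_ _≡_ (u ∷ v ∷ w ∷ [])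
triple-injective u≢v u≢w v≢w = injective-∷ (λ { 0F → u≢v ; 1F → u≢w }) (pair-injective v≢w)

-- Walks

ClosedUnder : ∀ {m} → (Fin m → Fin m → Bool) → (Fin m → Bool) → Set
ClosedUnder E B = ∀ u v → E u v ≡ true → B u ≡ B v

module _ {m : ℕ} {E : Fin m → Fin m → Bool} where

  reach-++ : ∀ {u v w} → Reach E u v → Reach E v w → Reach E u w
  reach-++ here       q = q
  reach-++ (step e p) q = step e (reach-++ p q)

  reach-sym : (∀ u v → E u v ≡ E v u) → ∀ {u v} → Reach E u v → Reach E v u
  reach-sym E-sym here                   = here
  reach-sym E-sym {u} (step {v = v} e p) = reach-++ (reach-sym E-sym p) (step (trans (E-sym v u) e) here)

  reach-closed : ∀ {B} → ClosedUnder E B → ∀ {u v} → Reach E u v → B u ≡ B v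
  reach-closed B-closed here       = refl
  reach-closed B-closed (step e p) = trans (B-closed _ _ e) (reach-closed B-closed p)

  reach-first-step : ∀ {u w} → Reach E u w → u ≢ w → ∃ λ v → E u v ≡ true
  reach-first-step here               u≢u = ⊥-elim (u≢u refl)
  reach-first-step (step {v = v} e _) _   = v , e

reach-map : ∀ {m m′} {E : Fin m → Fin m → Bool} {E′ : Fin m′ → Fin m′ → Bool} (f : Fin m → Fin m′) →
            (∀ u v → E u v ≡ true → E′ (f u) (f v) ≡ true) → ∀ {u v} → Reach E u v → Reach E′ (f u) (f v)
reach-map f f-hom here       = here
reach-map f f-hom (step e p) = step (f-hom _ _ e) (reach-map f f-hom p)

¬¬-decide-all : ∀ {m} (P : Fin m → Set) → ¬ ¬ (∀ i → Dec (P i))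
¬¬-decide-all {zero}  P ¬dec = ¬dec λ ()
¬¬-decide-all {suc m} P ¬dec = ¬¬-excluded-middle λ P₀? → ¬¬-decide-all (P ∘ suc) λ P? → ¬dec λ { zero → P₀? ; (suc i) → P? i }

Separation : ∀ {m} → (Fin m → Fin m → Bool) → Set
Separation {m} E = Σ (Fin m → Bool) λ B → ClosedUnder E B × (∃ λ u → B u ≡ true) × (∃ λ v → B v ≡ false)

-- Reachability is not decided here, so a union of components is only obtained under ¬¬;
-- every goal it serves is a decidable inequality.
¬¬-separation : ∀ {m} {E : Fin m → Fin m → Bool} → (∀ u v → E u v ≡ E v u) → ¬ ConnectedRel E → ¬ ¬ Separation E
¬¬-separation {zero}      E-sym disconnected _    = disconnected λ ()
¬¬-separation {suc m} {E} E-sym disconnected ¬sep = ¬¬-decide-all (Reach E zero) λ reach? → ¬sep (separation reach?)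
  where
  separation : (∀ v → Dec (Reach E zero v)) → Separation E
  separation reach? = B , B-closed , (zero , dec-true (reach? zero) here) , outside
    where
    B : Fin (suc m) → Bool
    B v = does (reach? v)
    B-closed : ClosedUnder E B
    B-closed u v e with reach? u | reach? v
    ... | yes _  | yes _  = refl
    ... | no  _  | no  _  = refl
    ... | yes r  | no  ¬r = ⊥-elim (¬r (reach-++ r (step e here)))
    ... | no  ¬r | yes r  = ⊥-elim (¬r (reach-++ r (step (trans (E-sym v u) e) here)))
    outside : ∃ λ v → B v ≡ false
    outside with all? reach?
    ... | yes all-reach = ⊥-elim (disconnected λ u v → reach-++ (reach-sym E-sym (all-reach u)) (all-reach v))
    ... | no  ¬all      = let (v , ¬r) = ¬∀⟶∃¬ _ _ reach? ¬all in v , dec-false (reach? v) ¬r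

-- Edge sets and cuts

size≡∑ : ∀ {X} (S : EdgeSet X) → size S ≡ ∑[ u < V X ] ∑[ v < V X ] ⟦ mem S u v ∧ (toℕ u <ᵇ toℕ v) ⟧
size≡∑ {X} S = trans (sum-map-allFin (λ u → count (λ v → mem S u v ∧ (toℕ u <ᵇ toℕ v))))
  (sum-cong-≗ λ u → count≡∑ (λ v → mem S u v ∧ (toℕ u <ᵇ toℕ v)))

size-mono : ∀ {X} {S S′ : EdgeSet X} → (∀ u v → mem S u v ≡ true → mem S′ u v ≡ true) → size S ≤ size S′
size-mono {X} {S} {S′} S⊆S′ = begin
  size S                                                          ≡⟨ size≡∑ S ⟩
  ∑[ u < V X ] ∑[ v < V X ] ⟦ mem S u v ∧ (toℕ u <ᵇ toℕ v) ⟧     ≤⟨ ∑-mono-≤ (λ u → ∑-mono-≤ (⟦mem⟧-mono u)) ⟩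
  ∑[ u < V X ] ∑[ v < V X ] ⟦ mem S′ u v ∧ (toℕ u <ᵇ toℕ v) ⟧    ≡⟨ sym (size≡∑ S′) ⟩
  size S′                                                         ∎
  where
  open ≤-Reasoning
  ⟦mem⟧-mono : ∀ u v → ⟦ mem S u v ∧ (toℕ u <ᵇ toℕ v) ⟧ ≤ ⟦ mem S′ u v ∧ (toℕ u <ᵇ toℕ v) ⟧
  ⟦mem⟧-mono u v with mem S u v in uv∈S
  ... | false = z≤n
  ... | true  rewrite S⊆S′ u v uv∈S = ≤-refl

twice-size : ∀ {X} (S : EdgeSet X) → (∀ u → mem S u u ≡ false) → 2 * size S ≡ ∑∑ (λ u v → ⟦ mem S u v ⟧)
twice-size {X} S loopless = begin
  2 * size S                                         ≡⟨ cong (2 *_) (size≡∑ S) ⟩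
  ∑∑ below + (∑∑ below + 0)                          ≡⟨ cong (∑∑ below +_) (trans (+-identityʳ (∑∑ below)) below≡above) ⟩
  ∑∑ below + ∑∑ above                                ≡⟨ ∑∑-distrib-+ below above ⟨
  ∑∑ (λ u v → below u v + above u v)                 ≡⟨ sum-cong-≗ (λ u → sum-cong-≗ (split u)) ⟩
  ∑∑ (λ u v → ⟦ mem S u v ⟧)                         ∎
  where
  open ≡-Reasoning
  below above : Fin (V X) → Fin (V X) → ℕ
  below u v = ⟦ mem S u v ∧ (toℕ u <ᵇ toℕ v) ⟧
  above u v = ⟦ mem S u v ∧ (toℕ v <ᵇ toℕ u) ⟧
  below≡above : ∑∑ below ≡ ∑∑ above
  below≡above = trans (∑-comm below) (sum-cong-≗ λ v → sum-cong-≗ λ u →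
                  cong (λ b → ⟦ b ∧ (toℕ u <ᵇ toℕ v) ⟧) (symm S u v))
  split : ∀ u v → below u v + above u v ≡ ⟦ mem S u v ⟧
  split u v with <-cmp (toℕ u) (toℕ v)
  ... | tri< u<v _ _ rewrite <ᵇ-true u<v | <ᵇ-false (<⇒≤ u<v) | ∧-identityʳ (mem S u v) | ∧-zeroʳ (mem S u v) = +-identityʳ _
  ... | tri> _ _ v<u rewrite <ᵇ-true v<u | <ᵇ-false (<⇒≤ v<u) | ∧-identityʳ (mem S u v) | ∧-zeroʳ (mem S u v) = refl
  ... | tri≈ _ u≡v _ rewrite toℕ-injective u≡v | loopless v = refl

module SimpleGraph (X : Graph) (simple : IsSimple X) where

  adj-sym : ∀ u v → adj X u v ≡ adj X v u
  adj-sym = proj₁ simple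

  adj⇒≢ : ∀ {u v} → adj X u v ≡ true → u ≢ v
  adj⇒≢ {u} uv refl with () ← trans (sym (proj₂ simple u)) uv

  mem-irrefl : ∀ (S : EdgeSet X) u → mem S u u ≡ false
  mem-irrefl S u with mem S u u in uu∈S
  ... | false = refl
  ... | true  = ⊥-elim (adj⇒≢ (subset S u u uu∈S) refl)

  minus-sym : ∀ S u v → minus X S u v ≡ minus X S v u
  minus-sym S u v = cong₂ (λ a b → a ∧ not b) (adj-sym u v) (symm S u v)

  cut : (Fin (V X) → Bool) → EdgeSet X
  cut B = record
    { mem    = λ u v → adj X u v ∧ (B u xor B v)
    ; symm   = λ u v → cong₂ _∧_ (adj-sym u v) (xor-comm (B u) (B v))
    ; subset = λ u v → ∧-true-left
    }

  twice-size-cut : ∀ B → 2 * size (cut B) ≡ ∑∑ (λ u v → ⟦ adj X u v ⟧ * ⟦ B u xor B v ⟧)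
  twice-size-cut B = trans (twice-size (cut B) (mem-irrefl (cut B)))
                           (sum-cong-≗ λ u → sum-cong-≗ λ v → ⟦∧⟧ (adj X u v) (B u xor B v))

  cut-closed : ∀ B → ClosedUnder (minus X (cut B)) B
  cut-closed B u v uv with adj X u v | B u | B v
  ... | true | true  | true  = refl
  ... | true | false | false = refl

  minus-cut : ∀ B {u v} → adj X u v ≡ true → B u ≡ B v → minus X (cut B) u v ≡ true
  minus-cut B {u} {v} uv Bu≡Bv rewrite uv | Bu≡Bv | xor-same (B v) = refl

  cut-disconnects : ∀ B {u v} → B u ≡ true → B v ≡ false → ¬ ConnectedRel (minus X (cut B))
  cut-disconnects B {u} {v} Bu Bv connected
    with () ← trans (sym Bu) (trans (reach-closed (cut-closed B) (connected u v)) Bv)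

  size-cut≤ : ∀ S B → ClosedUnder (minus X S) B → size (cut B) ≤ size S
  size-cut≤ S B B-closed = size-mono {X} {cut B} {S} cut⊆S
    where
    cut⊆S : ∀ u v → mem (cut B) u v ≡ true → mem S u v ≡ true
    cut⊆S u v uv∈cut with adj X u v in uv | mem S u v in uv∈S
    ... | _    | true  = refl
    ... | true | false
      with () ← trans (sym uv∈cut) (trans (cong (_xor B v) (B-closed u v (cong₂ (λ a b → a ∧ not b) uv uv∈S)))
                                          (xor-same (B v)))

  restricted⇒neighbour : ∀ {j S} → IsRestrictedCut X (suc (suc j)) S → ∀ u → ∃ λ v → minus X S u v ≡ true
  restricted⇒neighbour {j} (_ , component) u with component u
  ... | f , f-inj , reach-f with u ≟ f zero
  ...   | no  u≢f₀ = reach-first-step (reach-f zero) u≢f₀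
  ...   | yes u≡f₀ = reach-first-step (reach-f (suc zero)) (λ u≡f₁ → 0≢1 (f-inj (trans (sym u≡f₀) u≡f₁)))
    where
    0≢1 : Fin.zero {suc j} ≢ suc zero
    0≢1 ()

  restricted⇒≤count : ∀ {j S B} → IsRestrictedCut X j S → ClosedUnder (minus X S) B →
                      ∀ {u} → B u ≡ true → j ≤ ∑[ v < V X ] ⟦ B v ⟧
  restricted⇒≤count (_ , component) B-closed {u} Bu with component u
  ... | f , f-inj , reach-f = injective⇒≤count f-inj _ (λ i → trans (sym (reach-closed B-closed (reach-f i))) Bu)

  cut-restricted₂ : ∀ B {u v} → B u ≡ true → B v ≡ false →
                    (∀ w → ∃ λ w′ → adj X w w′ ≡ true × B w ≡ B w′) → IsRestrictedCut X 2 (cut B)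
  cut-restricted₂ B Bu Bv same-side = cut-disconnects B Bu Bv , component
    where
    component : ∀ w → Σ (Fin 2 → Fin (V X)) λ f →
                Injective _≡_ _≡_ f × (∀ i → Reach (minus X (cut B)) w (f i))
    component w with same-side w
    ... | w′ , ww′ , Bw≡Bw′ =
      (w ∷ w′ ∷ []) , pair-injective (adj⇒≢ ww′) , λ { 0F → here ; 1F → step (minus-cut B ww′ Bw≡Bw′) here }

-- Crossing pairs between two fibres

Mixed : ℕ → ℕ → Set
Mixed n x = 0 < x × x < n

-- The number of edges of G × Tₙ between the fibres over adjacent u and v that cross a cut with
-- fibre sizes x and y (see ∑∑-xor).
cross : ℕ → ℕ → ℕ → ℕ
cross n x y = x * (n ∸ y) + (n ∸ x) * y

cross-comm : ∀ n x y → cross n x y ≡ cross n y x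
cross-comm n x y = trans (+-comm (x * (n ∸ y)) _) (cong₂ _+_ (*-comm (n ∸ x) y) (*-comm x (n ∸ y)))

cross-+-2* : ∀ {n x y} → x ≤ n → y ≤ n → cross n x y + 2 * (x * y) ≡ n * x + n * y
cross-+-2* {n} {x} {y} x≤n y≤n = begin
  x * (n ∸ y) + (n ∸ x) * y + 2 * (x * y)         ≡⟨ regroup (x * (n ∸ y)) ((n ∸ x) * y) (x * y) ⟩
  (x * (n ∸ y) + x * y) + ((n ∸ x) * y + x * y)   ≡⟨ cong₂ _+_ (sym (*-distribˡ-+ x (n ∸ y) y)) (sym (*-distribʳ-+ y (n ∸ x) x)) ⟩
  x * (n ∸ y + y) + (n ∸ x + x) * y               ≡⟨ cong₂ (λ a b → x * a + b * y) (m∸n+n≡m y≤n) (m∸n+n≡m x≤n) ⟩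
  x * n + n * y                                   ≡⟨ cong (_+ n * y) (*-comm x n) ⟩
  n * x + n * y                                   ∎
  where
  open ≡-Reasoning
  regroup : ∀ a b c → a + b + 2 * c ≡ (a + c) + (b + c)
  regroup = solve-∀

∑∑-xor : ∀ n (p q : Fin n → Bool) →
         ∑[ b < n ] ∑[ c < n ] ⟦ p b xor q c ⟧ ≡ cross n (∑[ b < n ] ⟦ p b ⟧) (∑[ c < n ] ⟦ q c ⟧)
∑∑-xor n p q = begin
  ∑[ b < n ] ∑[ c < n ] ⟦ p b xor q c ⟧                   ≡⟨ sum-cong-≗ (λ b → row (p b)) ⟩
  ∑[ b < n ] (⟦ p b ⟧ * (n ∸ Q) + ⟦ not (p b) ⟧ * Q)       ≡⟨ ∑-distrib-+ (λ b → ⟦ p b ⟧ * (n ∸ Q)) (λ b → ⟦ not (p b) ⟧ * Q) ⟩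
  ∑[ b < n ] (⟦ p b ⟧ * (n ∸ Q)) + ∑[ b < n ] (⟦ not (p b) ⟧ * Q)
    ≡⟨ cong₂ _+_ (*-distribʳ-sum (n ∸ Q) (λ b → ⟦ p b ⟧)) (*-distribʳ-sum Q (λ b → ⟦ not (p b) ⟧)) ⟨
  P * (n ∸ Q) + ∑[ b < n ] ⟦ not (p b) ⟧ * Q              ≡⟨ cong (λ z → P * (n ∸ Q) + z * Q) (count-not p) ⟩
  cross n P Q                                              ∎
  where
  open ≡-Reasoning
  P Q : ℕ
  P = ∑[ b < n ] ⟦ p b ⟧
  Q = ∑[ c < n ] ⟦ q c ⟧
  row : ∀ pb → ∑[ c < n ] ⟦ pb xor q c ⟧ ≡ ⟦ pb ⟧ * (n ∸ Q) + ⟦ not pb ⟧ * Q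
  row true  = trans (count-not q) (sym (trans (cong (_+ 0) (+-identityʳ (n ∸ Q))) (+-identityʳ (n ∸ Q))))
  row false = sym (+-identityʳ Q)

∑-threshold-xor : ∀ n x y → ∑[ θ < n ] ⟦ (toℕ θ <ᵇ x) xor (toℕ θ <ᵇ y) ⟧ ≤ (x ∸ y) + (y ∸ x)
∑-threshold-xor zero    x       y       = z≤n
∑-threshold-xor (suc n) zero    zero    = ∑-threshold-xor n 0 0
∑-threshold-xor (suc n) zero    (suc y) = s≤s (≤-trans (∑-threshold-xor n 0 y) (≤-reflexive (cong (_+ y) (0∸n≡0 y))))
∑-threshold-xor (suc n) (suc x) zero    = s≤s (≤-trans (∑-threshold-xor n x 0) (≤-reflexive (cong (x +_) (0∸n≡0 x))))
∑-threshold-xor (suc n) (suc x) (suc y) = ∑-threshold-xor n x y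

cross-dist-ordered : ∀ {n x y} → x ≤ n → y ≤ x → n * ((x ∸ y) + (y ∸ x)) ≤ cross n x y
cross-dist-ordered {y = y} x≤n y≤x
  with d , refl ← m≤n⇒∃[o]m+o≡n y≤x | e , refl ← m≤n⇒∃[o]m+o≡n x≤n = begin
  (y + d + e) * ((y + d ∸ y) + (y ∸ (y + d)))
    ≡⟨ cong ((y + d + e) *_) (cong₂ _+_ (m+n∸m≡n y d) (m≤n⇒m∸n≡0 (m≤m+n y d))) ⟩
  (y + d + e) * (d + 0)
    ≤⟨ m≤m+n _ (2 * (e * y)) ⟩
  (y + d + e) * (d + 0) + 2 * (e * y)
    ≡⟨ expand y d e ⟩
  (y + d) * (d + e) + e * y
    ≡⟨ cong₂ (λ a b → (y + d) * a + b * y) (trans (cong (_∸ y) (+-assoc y d e)) (m+n∸m≡n y (d + e))) (m+n∸m≡n (y + d) e) ⟨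
  cross (y + d + e) (y + d) y
    ∎
  where
  open ≤-Reasoning
  expand : ∀ y d e → (y + d + e) * (d + 0) + 2 * (e * y) ≡ (y + d) * (d + e) + e * y
  expand = solve-∀

n*dist≤cross : ∀ {n x y} → x ≤ n → y ≤ n → n * ((x ∸ y) + (y ∸ x)) ≤ cross n x y
n*dist≤cross {n} {x} {y} x≤n y≤n with ≤-total x y
... | inj₁ x≤y = subst₂ _≤_ (cong (n *_) (+-comm (y ∸ x) (x ∸ y))) (cross-comm n y x) (cross-dist-ordered y≤n x≤y)
... | inj₂ y≤x = cross-dist-ordered x≤n y≤x

n≤cross : ∀ {n x y} → Mixed n x → y ≤ n → n ≤ cross n x y
n≤cross {n} {x} {y} (0<x , x<n) y≤n = begin
  n                                ≡⟨ m∸n+n≡m y≤n ⟨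
  (n ∸ y) + y                      ≡⟨ cong₂ _+_ (*-identityˡ (n ∸ y)) (*-identityˡ y) ⟨
  1 * (n ∸ y) + 1 * y              ≤⟨ +-mono-≤ (*-monoˡ-≤ (n ∸ y) 0<x) (*-monoˡ-≤ y (m<n⇒0<n∸m x<n)) ⟩
  cross n x y                      ∎
  where open ≤-Reasoning

2n≤cross+2 : ∀ {n x y} → Mixed n x → Mixed n y → 2 * n ≤ cross n x y + 2
2n≤cross+2 {n} {x} {y} (0<x , x<n) (0<y , y<n) = begin
  2 * n                                    ≡⟨ cong₂ (λ a b → a + (b + 0)) (m∸n+n≡m (<⇒≤ y<n)) (m∸n+n≡m (<⇒≤ x<n)) ⟨
  (n ∸ y + y) + ((n ∸ x + x) + 0)          ≡⟨ regroup (n ∸ y) y (n ∸ x) x ⟩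
  (x + (n ∸ y)) + ((n ∸ x) + y)            ≤⟨ +-mono-≤ (+≤*+1 0<x (m<n⇒0<n∸m y<n)) (+≤*+1 (m<n⇒0<n∸m x<n) 0<y) ⟩
  (x * (n ∸ y) + 1) + ((n ∸ x) * y + 1)    ≡⟨ regroup′ (x * (n ∸ y)) ((n ∸ x) * y) ⟩
  cross n x y + 2                          ∎
  where
  open ≤-Reasoning
  regroup : ∀ a b c d → (a + b) + ((c + d) + 0) ≡ (d + a) + (c + b)
  regroup = solve-∀
  regroup′ : ∀ a b → (a + 1) + (b + 1) ≡ a + b + 2
  regroup′ = solve-∀
  +≤*+1 : ∀ {a b} → 0 < a → 0 < b → a + b ≤ a * b + 1
  +≤*+1 {suc a} {suc b} _ _ = ≤-trans (m≤m+n (suc a + suc b) (a * b)) (≤-reflexive (expand a b))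
    where
    expand : ∀ a b → suc a + suc b + a * b ≡ suc a * suc b + 1
    expand = solve-∀

-- With K = kn, twice this reads 6kn − 8 ≤ 2kn(x + y) − 4xy, whose right side is twice the cut
-- size of a side lying over an edge of G with fibre sizes x and y.
two-mixed-fibres-arith : ∀ K x y → 0 < x → 0 < y → 3 ≤ x + y → 2 * (y + 1) ≤ K →
                         3 * K + 2 * (x * y) ≤ K * (x + y) + 4
two-mixed-fibres-arith K (suc zero)          (suc zero)     _ _ (s≤s (s≤s ())) _
two-mixed-fibres-arith K (suc (suc s))       (suc zero)     _ _ _ 4≤K
  with r , refl ← m≤n⇒∃[o]m+o≡n 4≤K = ≤-trans (m≤m+n _ ((2 + r) * s)) (≤-reflexive (expand r s))
  where
  expand : ∀ r s → 3 * (2 * (1 + 1) + r) + 2 * ((2 + s) * 1) + (2 + r) * s ≡ (2 * (1 + 1) + r) * ((2 + s) + 1) + 4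
  expand = solve-∀
two-mixed-fibres-arith K (suc x) (suc (suc w)) _ _ _ 2y+2≤K
  with r , refl ← m≤n⇒∃[o]m+o≡n 2y+2≤K = ≤-trans (m≤m+n _ (2 * (w * w) + 2 * x + 4 * w + r * (x + w))) (≤-reflexive (expand r x w))
  where
  expand : ∀ r x w → 3 * (2 * ((2 + w) + 1) + r) + 2 * ((1 + x) * (2 + w)) + (2 * (w * w) + 2 * x + 4 * w + r * (x + w))
                     ≡ (2 * ((2 + w) + 1) + r) * ((1 + x) + (2 + w)) + 4
  expand = solve-∀

-- Regular graphs

module RegularGraph (G : Graph) (k : ℕ) (simple : IsSimple G) (regular : IsRegular G k) where
  open SimpleGraph G simple public

  arcSum : (Fin (V G) → Fin (V G) → ℕ) → ℕ
  arcSum f = ∑[ u < V G ] ∑[ v < V G ] (⟦ adj G u v ⟧ * f u v)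

  arcSum-cong : ∀ {f g} → (∀ u v → adj G u v ≡ true → f u v ≡ g u v) → arcSum f ≡ arcSum g
  arcSum-cong f≡g = sum-cong-≗ λ u → sum-cong-≗ λ v → ⟦⟧*-cong (adj G u v) (f≡g u v)

  arcSum-mono : ∀ {f g} → (∀ u v → adj G u v ≡ true → f u v ≤ g u v) → arcSum f ≤ arcSum g
  arcSum-mono f≤g = ∑-mono-≤ λ u → ∑-mono-≤ λ v → ⟦⟧*-mono (adj G u v) (f≤g u v)

  arcSum-distrib-+ : ∀ f g → arcSum (λ u v → f u v + g u v) ≡ arcSum f + arcSum g
  arcSum-distrib-+ f g = trans (sum-cong-≗ λ u → sum-cong-≗ λ v → *-distribˡ-+ ⟦ adj G u v ⟧ (f u v) (g u v))
                               (∑∑-distrib-+ (λ u v → ⟦ adj G u v ⟧ * f u v) (λ u v → ⟦ adj G u v ⟧ * g u v))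

  arcSum-*ˡ : ∀ c f → arcSum (λ u v → c * f u v) ≡ c * arcSum f
  arcSum-*ˡ c f = begin
    ∑∑ (λ u v → ⟦ adj G u v ⟧ * (c * f u v))    ≡⟨ sum-cong-≗ (λ u → sum-cong-≗ λ v → x*[c*y]≡c*[x*y] ⟦ adj G u v ⟧ c (f u v)) ⟩
    ∑[ u < V G ] ∑[ v < V G ] (c * arc f u v)    ≡⟨ sum-cong-≗ (λ u → *-distribˡ-sum c (arc f u)) ⟨
    ∑[ u < V G ] (c * ∑[ v < V G ] arc f u v)    ≡⟨ *-distribˡ-sum c (λ u → ∑[ v < V G ] arc f u v) ⟨
    c * arcSum f                                 ∎
    where
    open ≡-Reasoning
    arc : (Fin (V G) → Fin (V G) → ℕ) → Fin (V G) → Fin (V G) → ℕ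
    arc f u v = ⟦ adj G u v ⟧ * f u v
    x*[c*y]≡c*[x*y] : ∀ x c y → x * (c * y) ≡ c * (x * y)
    x*[c*y]≡c*[x*y] = solve-∀

  arcSum-flip : ∀ f → arcSum (λ u v → f v u) ≡ arcSum f
  arcSum-flip f = trans (∑-comm (λ u v → ⟦ adj G u v ⟧ * f v u))
                        (sum-cong-≗ λ v → sum-cong-≗ λ u → cong (λ b → ⟦ b ⟧ * f v u) (adj-sym u v))

  degree≡∑ : ∀ u → ∑[ v < V G ] ⟦ adj G u v ⟧ ≡ k
  degree≡∑ u = trans (sym (count≡∑ (adj G u))) (regular u)

  arcSum-source : ∀ (w : Fin (V G) → ℕ) → arcSum (λ u v → w u) ≡ k * sum w
  arcSum-source w = begin
    ∑[ u < V G ] ∑[ v < V G ] (⟦ adj G u v ⟧ * w u)   ≡⟨ sum-cong-≗ (λ u → *-distribʳ-sum (w u) (λ v → ⟦ adj G u v ⟧)) ⟨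
    ∑[ u < V G ] (∑[ v < V G ] ⟦ adj G u v ⟧ * w u)   ≡⟨ sum-cong-≗ (λ u → cong (_* w u) (degree≡∑ u)) ⟩
    ∑[ u < V G ] (k * w u)                             ≡⟨ *-distribˡ-sum k w ⟨
    k * sum w                                          ∎
    where open ≡-Reasoning

  handshake : ∀ (w : Fin (V G) → ℕ) → arcSum (λ u v → w u + w v) ≡ 2 * (k * sum w)
  handshake w = begin
    arcSum (λ u v → w u + w v)                ≡⟨ arcSum-distrib-+ (λ u v → w u) (λ u v → w v) ⟩
    arcSum (λ u v → w u) + arcSum (λ u v → w v) ≡⟨ cong (arcSum (λ u v → w u) +_) (arcSum-flip (λ u v → w u)) ⟩
    arcSum (λ u v → w u) + arcSum (λ u v → w u) ≡⟨ cong (λ s → s + s) (arcSum-source w) ⟩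
    k * sum w + k * sum w                     ≡⟨ cong (k * sum w +_) (+-identityʳ (k * sum w)) ⟨
    2 * (k * sum w)                           ∎
    where open ≡-Reasoning

  crossWeight : ℕ → (Fin (V G) → ℕ) → ℕ
  crossWeight n a = arcSum (λ u v → cross n (a u) (a v))

  crossWeight-identity : ∀ {n} a → (∀ u → a u ≤ n) →
                         crossWeight n a + 2 * arcSum (λ u v → a u * a v) ≡ 2 * (k * (n * sum a))
  crossWeight-identity {n} a a≤n = begin
    crossWeight n a + 2 * arcSum (λ u v → a u * a v)
      ≡⟨ cong (crossWeight n a +_) (arcSum-*ˡ 2 (λ u v → a u * a v)) ⟨
    crossWeight n a + arcSum (λ u v → 2 * (a u * a v))
      ≡⟨ arcSum-distrib-+ (λ u v → cross n (a u) (a v)) (λ u v → 2 * (a u * a v)) ⟨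
    arcSum (λ u v → cross n (a u) (a v) + 2 * (a u * a v))
      ≡⟨ arcSum-cong (λ u v _ → cross-+-2* (a≤n u) (a≤n v)) ⟩
    arcSum (λ u v → n * a u + n * a v)
      ≡⟨ handshake (λ u → n * a u) ⟩
    2 * (k * ∑[ u < V G ] (n * a u))
      ≡⟨ cong (λ s → 2 * (k * s)) (*-distribˡ-sum n a) ⟨
    2 * (k * (n * sum a))
      ∎
    where open ≡-Reasoning

  arcSum-supported : ∀ {j} {t : Fin j → Fin (V G)} → Injective _≡_ _≡_ t →
    ∀ (f : Fin (V G) → ℕ) → (∀ v → ¬ (∃ λ i → t i ≡ v) → f v ≡ 0) →
    arcSum (λ u v → f u * f v) ≡ ∑[ i < j ] ∑[ i′ < j ] (⟦ adj G (t i) (t i′) ⟧ * (f (t i) * f (t i′)))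
  arcSum-supported {j} {t} t-inj f f-supp =
    trans (sum-cong-≗ inner) (∑-supported t-inj (λ u → ∑[ i′ < j ] (⟦ adj G u (t i′) ⟧ * (f u * f (t i′)))) outer)
    where
    inner : ∀ u → ∑[ v < V G ] (⟦ adj G u v ⟧ * (f u * f v)) ≡ ∑[ i′ < j ] (⟦ adj G u (t i′) ⟧ * (f u * f (t i′)))
    inner u = ∑-supported t-inj (λ v → ⟦ adj G u v ⟧ * (f u * f v)) λ v v∉t →
      trans (cong (λ z → ⟦ adj G u v ⟧ * (f u * z)) (f-supp v v∉t)) (*-zeroʳ-twice ⟦ adj G u v ⟧ (f u))
      where
      *-zeroʳ-twice : ∀ a b → a * (b * 0) ≡ 0
      *-zeroʳ-twice = solve-∀
    outer : ∀ u → ¬ (∃ λ i → t i ≡ u) → ∑[ i′ < j ] (⟦ adj G u (t i′) ⟧ * (f u * f (t i′))) ≡ 0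
    outer u u∉t = trans (sum-cong-≗ λ i′ → trans (cong (λ z → ⟦ adj G u (t i′) ⟧ * (z * f (t i′))) (f-supp u u∉t))
                                                 (*-zeroʳ ⟦ adj G u (t i′) ⟧))
                        (∑-zero j)

  arcsWithin : ∀ {j} → (Fin j → Fin (V G)) → ℕ
  arcsWithin {j} t = ∑[ i < j ] ∑[ i′ < j ] ⟦ adj G (t i) (t i′) ⟧

  arcSum-image : ∀ {j} {t : Fin j → Fin (V G)} → Injective _≡_ _≡_ t →
                 arcSum (λ u v → ⟦ does (image? t u) ⟧ * ⟦ does (image? t v) ⟧) ≡ arcsWithin t
  arcSum-image {t = t} t-inj =
    trans (arcSum-supported t-inj (λ v → ⟦ does (image? t v) ⟧) (λ v v∉t → cong ⟦_⟧ (dec-false (image? t v) v∉t)))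
          (sum-cong-≗ λ i → sum-cong-≗ λ i′ →
            trans (cong₂ (λ x y → ⟦ adj G (t i) (t i′) ⟧ * (x * y)) (⟦image⟧-at t i) (⟦image⟧-at t i′))
                  (*-identityʳ ⟦ adj G (t i) (t i′) ⟧))

  mixed-fibres-bound : ∀ {n j} {t : Fin j → Fin (V G)} → Injective _≡_ _≡_ t →
    ∀ a → (∀ u → a u ≤ n) → (∀ i → Mixed n (a (t i))) →
    2 * (k * (n * j)) ≤ crossWeight n a + 2 * arcsWithin t
  mixed-fibres-bound {n} {j} {t} t-inj a a≤n mixed = begin
    2 * (k * (n * j))                                      ≡⟨ cong (λ s → 2 * (k * (n * s))) (∑-⟦image⟧ t-inj) ⟨
    2 * (k * (n * sum τ))                                  ≡⟨ cong (λ s → 2 * (k * s)) (*-distribˡ-sum n τ) ⟩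
    2 * (k * ∑[ u < V G ] (n * τ u))                       ≡⟨ handshake (λ u → n * τ u) ⟨
    arcSum (λ u v → n * τ u + n * τ v)                     ≤⟨ arcSum-mono (λ u v _ → bound u v) ⟩
    arcSum (λ u v → cross n (a u) (a v) + 2 * (τ u * τ v)) ≡⟨ arcSum-distrib-+ _ (λ u v → 2 * (τ u * τ v)) ⟩
    crossWeight n a + arcSum (λ u v → 2 * (τ u * τ v))     ≡⟨ cong (crossWeight n a +_) (arcSum-*ˡ 2 (λ u v → τ u * τ v)) ⟩
    crossWeight n a + 2 * arcSum (λ u v → τ u * τ v)       ≡⟨ cong (λ s → crossWeight n a + 2 * s) (arcSum-image t-inj) ⟩
    crossWeight n a + 2 * arcsWithin t                     ∎
    where
    open ≤-Reasoning
    τ : Fin (V G) → ℕ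
    τ v = ⟦ does (image? t v) ⟧
    n*1+n*1 : ∀ n → n * 1 + n * 1 ≡ 2 * n
    n*1+n*1 = solve-∀
    n*1+n*0 : ∀ n → n * 1 + n * 0 ≡ n
    n*1+n*0 = solve-∀
    n*0+n*1 : ∀ n → n * 0 + n * 1 ≡ n
    n*0+n*1 = solve-∀
    n*0+n*0 : ∀ n → n * 0 + n * 0 ≡ 0
    n*0+n*0 = solve-∀
    bound : ∀ u v → n * τ u + n * τ v ≤ cross n (a u) (a v) + 2 * (τ u * τ v)
    bound u v with image? t u | image? t v
    ... | yes (i , refl) | yes (i′ , refl) = ≤-trans (≤-reflexive (n*1+n*1 n)) (2n≤cross+2 (mixed i) (mixed i′))
    ... | yes (i , refl) | no _ = ≤-trans (≤-reflexive (n*1+n*0 n)) (≤-trans (n≤cross (mixed i) (a≤n v)) (m≤m+n _ 0))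
    ... | no _ | yes (i′ , refl) = ≤-trans (≤-reflexive (n*0+n*1 n))
      (≤-trans (n≤cross (mixed i′) (a≤n u)) (≤-trans (≤-reflexive (cross-comm n (a (t i′)) (a u))) (m≤m+n _ 0)))
    ... | no _ | no _ = ≤-trans (≤-reflexive (n*0+n*0 n)) z≤n

  two-mixed-fibres-bound : ∀ {n u w} (a : Fin (V G) → ℕ) → adj G u w ≡ true →
    (∀ v → v ≢ u → v ≢ w → a v ≡ 0) → (∀ v → a v ≤ n) →
    Mixed n (a u) → Mixed n (a w) → 3 ≤ sum a → 2 ≤ k →
    2 * (k * (n * 3)) ≤ crossWeight n a + 8
  two-mixed-fibres-bound {n} {u} {w} a uw a-supp a≤n (0<x , _) (0<y , y<n) 3≤∑a 2≤k =
    +-cancelʳ-≤ (2 * (2 * (x * y))) _ _ (begin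
      2 * (k * (n * 3)) + 2 * (2 * (x * y))
        ≡⟨ regroup k n x y ⟩
      2 * (3 * (k * n) + 2 * (x * y))
        ≤⟨ *-monoʳ-≤ 2 (two-mixed-fibres-arith (k * n) x y 0<x 0<y 3≤x+y 2[y+1]≤kn) ⟩
      2 * ((k * n) * (x + y) + 4)
        ≡⟨ regroup′ k n x y ⟩
      2 * (k * (n * (x + (y + 0)))) + 8
        ≡⟨ cong (λ s → 2 * (k * (n * s)) + 8) sum-a ⟨
      2 * (k * (n * sum a)) + 8
        ≡⟨ cong (_+ 8) (crossWeight-identity a a≤n) ⟨
      crossWeight n a + 2 * arcSum (λ v v′ → a v * a v′) + 8
        ≡⟨ cong (λ s → crossWeight n a + 2 * s + 8) arcs ⟩
      crossWeight n a + 2 * (2 * (x * y)) + 8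
        ≡⟨ swap (crossWeight n a) (2 * (2 * (x * y))) 8 ⟩
      crossWeight n a + 8 + 2 * (2 * (x * y))
        ∎)
    where
    open ≤-Reasoning
    x y : ℕ
    x = a u
    y = a w
    2[y+1]≤kn : 2 * (y + 1) ≤ k * n
    2[y+1]≤kn = ≤-trans (≤-reflexive (cong (2 *_) (+-comm y 1))) (*-mono-≤ 2≤k y<n)
    t : Fin 2 → Fin (V G)
    t = u ∷ w ∷ []
    t-inj : Injective _≡_ _≡_ t
    t-inj = pair-injective (adj⇒≢ uw)
    supp : ∀ v → ¬ (∃ λ i → t i ≡ v) → a v ≡ 0
    supp v v∉t = a-supp v (λ v≡u → v∉t (zero , sym v≡u)) (λ v≡w → v∉t (suc zero , sym v≡w))
    sum-a : sum a ≡ x + (y + 0)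
    sum-a = ∑-supported t-inj a supp
    3≤x+y : 3 ≤ x + y
    3≤x+y = subst (3 ≤_) (trans sum-a (cong (x +_) (+-identityʳ y))) 3≤∑a
    arcs : arcSum (λ v v′ → a v * a v′) ≡ 2 * (x * y)
    arcs rewrite arcSum-supported t-inj a supp | proj₂ simple u | proj₂ simple w | uw | trans (adj-sym w u) uw
      = count-arcs x y
      where
      count-arcs : ∀ x y → 0 * (x * x) + (1 * (x * y) + 0) + (1 * (y * x) + (0 * (y * y) + 0) + 0) ≡ 2 * (x * y)
      count-arcs = solve-∀
    regroup : ∀ k n x y → 2 * (k * (n * 3)) + 2 * (2 * (x * y)) ≡ 2 * (3 * (k * n) + 2 * (x * y))
    regroup = solve-∀
    regroup′ : ∀ k n x y → 2 * ((k * n) * (x + y) + 4) ≡ 2 * (k * (n * (x + (y + 0)))) + 8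
    regroup′ = solve-∀
    swap : ∀ c d e → c + d + e ≡ c + e + d
    swap = solve-∀

  -- min(λ₂(G), k), with nothing standing for λ₂(G) = ∞.
  λ₂⊓k : Maybe ℕ → ℕ
  λ₂⊓k = maybe (_⊓ k) k

  isolated⇒k≤size-cut : ∀ B u → (∀ v → adj G u v ≡ true → B u ≢ B v) → k ≤ size (cut B)
  isolated⇒k≤size-cut B u isolated = *-cancelˡ-≤ 2 (begin
    k + (k + 0)                                          ≡⟨ cong₂ (λ r c → r + (c + 0)) (trans (sum-cong-≗ row) (degree≡∑ u))
                                                                                         (trans (sum-cong-≗ column) (degree≡∑ u)) ⟨
    ∑[ v < V G ] g u v + (∑[ v < V G ] g v u + 0)        ≡⟨ cong (∑[ v < V G ] g u v +_) (+-identityʳ _) ⟩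
    ∑[ v < V G ] g u v + ∑[ v < V G ] g v u              ≤⟨ ∑∑-row+col≤ g u (cong (λ b → ⟦ b ⟧ * _) (proj₂ simple u)) ⟩
    ∑[ x < V G ] ∑[ y < V G ] g x y                      ≡⟨ twice-size-cut B ⟨
    2 * size (cut B)                                     ∎)
    where
    open ≤-Reasoning
    g : Fin (V G) → Fin (V G) → ℕ
    g x y = ⟦ adj G x y ⟧ * ⟦ B x xor B y ⟧
    xor-≢ : ∀ {a b} → a ≢ b → a xor b ≡ true
    xor-≢ {false} {false} a≢b = ⊥-elim (a≢b refl)
    xor-≢ {false} {true}  _   = refl
    xor-≢ {true}  {false} _   = refl
    xor-≢ {true}  {true}  a≢b = ⊥-elim (a≢b refl)
    row : ∀ v → g u v ≡ ⟦ adj G u v ⟧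
    row v = trans (⟦⟧*-cong (adj G u v) (λ uv → cong ⟦_⟧ (xor-≢ (isolated v uv)))) (*-identityʳ _)
    column : ∀ v → g v u ≡ ⟦ adj G u v ⟧
    column v = trans (cong₂ (λ b c → ⟦ b ⟧ * ⟦ c ⟧) (adj-sym v u) (xor-comm (B v) (B u))) (row v)

  same-side-neighbour? : ∀ (B : Fin (V G) → Bool) w → Dec (∃ λ w′ → adj G w w′ ≡ true × B w ≡ B w′)
  same-side-neighbour? B w = any? λ w′ → (adj G w w′ ≟ᴮ true) ×-dec (B w ≟ᴮ B w′)

  λ₂⊓k≤size-cut : ∀ {l2} → LambdaIs G 2 l2 → ∀ B {u v} → B u ≡ true → B v ≡ false → λ₂⊓k l2 ≤ size (cut B)
  λ₂⊓k≤size-cut {l2} λ₂ B Bu Bv with all? (same-side-neighbour? B)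
  ... | yes same-side = bound l2 λ₂ (cut-restricted₂ B Bu Bv same-side)
    where
    bound : ∀ l2 → LambdaIs G 2 l2 → IsRestrictedCut G 2 (cut B) → λ₂⊓k l2 ≤ size (cut B)
    bound (just c) (_ , minimal) R = ≤-trans (m⊓n≤m c k) (minimal (cut B) R)
    bound nothing  none          R = ⊥-elim (none (cut B) R)
  ... | no ¬same-side with w , ¬w ← ¬∀⟶∃¬ (V G) _ (same-side-neighbour? B) ¬same-side =
    ≤-trans (λ₂⊓k≤k l2) (isolated⇒k≤size-cut B w λ w′ ww′ Bw≡Bw′ → ¬w (w′ , ww′ , Bw≡Bw′))
    where
    λ₂⊓k≤k : ∀ l2 → λ₂⊓k l2 ≤ k
    λ₂⊓k≤k (just c) = m⊓n≤n c k
    λ₂⊓k≤k nothing  = ≤-refl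

  arcSum-∑ : ∀ {m} (f : Fin m → Fin (V G) → Fin (V G) → ℕ) →
             ∑[ θ < m ] arcSum (f θ) ≡ arcSum (λ u v → ∑[ θ < m ] f θ u v)
  arcSum-∑ {m} f = begin
    ∑[ θ < m ] ∑[ u < V G ] ∑[ v < V G ] (⟦ adj G u v ⟧ * f θ u v)  ≡⟨ ∑-comm (λ θ u → ∑[ v < V G ] (⟦ adj G u v ⟧ * f θ u v)) ⟩
    ∑[ u < V G ] ∑[ θ < m ] ∑[ v < V G ] (⟦ adj G u v ⟧ * f θ u v)
      ≡⟨ sum-cong-≗ (λ u → ∑-comm (λ θ v → ⟦ adj G u v ⟧ * f θ u v)) ⟩
    ∑[ u < V G ] ∑[ v < V G ] ∑[ θ < m ] (⟦ adj G u v ⟧ * f θ u v)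
      ≡⟨ sum-cong-≗ (λ u → sum-cong-≗ λ v → *-distribˡ-sum ⟦ adj G u v ⟧ (λ θ → f θ u v)) ⟨
    arcSum (λ u v → ∑[ θ < m ] f θ u v)                              ∎
    where open ≡-Reasoning

  threshold-bound : ∀ {n} a → (∀ u → a u ≤ n) →
    n * ∑[ θ < n ] (2 * size (cut (λ u → toℕ θ <ᵇ a u))) ≤ crossWeight n a
  threshold-bound {n} a a≤n = begin
    n * ∑[ θ < n ] (2 * size (cut (above θ)))                        ≡⟨ cong (n *_) (sum-cong-≗ λ θ → twice-size-cut (above θ)) ⟩
    n * ∑[ θ < n ] arcSum (λ u v → ⟦ above θ u xor above θ v ⟧)
      ≡⟨ cong (n *_) (arcSum-∑ (λ θ u v → ⟦ above θ u xor above θ v ⟧)) ⟩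
    n * arcSum (λ u v → ∑[ θ < n ] ⟦ above θ u xor above θ v ⟧)      ≡⟨ arcSum-*ˡ n _ ⟨
    arcSum (λ u v → n * ∑[ θ < n ] ⟦ above θ u xor above θ v ⟧)      ≤⟨ arcSum-mono (λ u v _ → layer u v) ⟩
    crossWeight n a                                                  ∎
    where
    open ≤-Reasoning
    above : Fin n → Fin (V G) → Bool
    above θ u = toℕ θ <ᵇ a u
    layer : ∀ u v → n * ∑[ θ < n ] ⟦ above θ u xor above θ v ⟧ ≤ cross n (a u) (a v)
    layer u v = ≤-trans (*-monoʳ-≤ n (∑-threshold-xor n (a u) (a v))) (n*dist≤cross (a≤n u) (a≤n v))

  full-and-empty-fibres-bound : ∀ {n l2 p z} → LambdaIs G 2 l2 → ∀ a → (∀ u → a u ≤ n) → a p ≡ n → a z ≡ 0 →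
    2 * (n * (n * λ₂⊓k l2)) ≤ crossWeight n a
  full-and-empty-fibres-bound {n} {l2} {p} {z} λ₂ a a≤n ap≡n az≡0 = begin
    2 * (n * (n * λ₂⊓k l2))                              ≡⟨ regroup n (λ₂⊓k l2) ⟩
    n * (n * (2 * λ₂⊓k l2))                              ≡⟨ cong (n *_) (∑-const n (2 * λ₂⊓k l2)) ⟨
    n * ∑[ θ < n ] (2 * λ₂⊓k l2)
      ≤⟨ *-monoʳ-≤ n (∑-mono-≤ λ θ → *-monoʳ-≤ 2 (λ₂⊓k≤size-cut λ₂ (above θ) (p-above θ) (z-below θ))) ⟩
    n * ∑[ θ < n ] (2 * size (cut (above θ)))            ≤⟨ threshold-bound a a≤n ⟩
    crossWeight n a                                      ∎
    where
    open ≤-Reasoning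
    above : Fin n → Fin (V G) → Bool
    above θ u = toℕ θ <ᵇ a u
    p-above : ∀ θ → above θ p ≡ true
    p-above θ = <ᵇ-true (subst (toℕ θ <_) (sym ap≡n) (toℕ<n θ))
    z-below : ∀ θ → above θ z ≡ false
    z-below θ = subst (λ c → (toℕ θ <ᵇ c) ≡ false) (sym az≡0) (<ᵇ-false {toℕ θ} z≤n)
    regroup : ∀ n m → 2 * (n * (n * m)) ≡ n * (n * (2 * m))
    regroup = solve-∀

  neighbour : 0 < k → ∀ u → ∃ λ v → adj G u v ≡ true
  neighbour 0<k u = count>0⇒∃ (adj G u) (subst (0 <_) (sym (degree≡∑ u)) 0<k)

  arcsWithin-triple : ∀ (t : Fin 3 → Fin (V G)) →
    arcsWithin t ≡ 2 * (⟦ adj G (t 0F) (t 1F) ⟧ + ⟦ adj G (t 0F) (t 2F) ⟧ + ⟦ adj G (t 1F) (t 2F) ⟧)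
  arcsWithin-triple t
    rewrite proj₂ simple (t 0F) | proj₂ simple (t 1F) | proj₂ simple (t 2F)
          | adj-sym (t 1F) (t 0F) | adj-sym (t 2F) (t 0F) | adj-sym (t 2F) (t 1F)
    = tally ⟦ adj G (t 0F) (t 1F) ⟧ ⟦ adj G (t 0F) (t 2F) ⟧ ⟦ adj G (t 1F) (t 2F) ⟧
    where
    tally : ∀ a b c → 0 + (a + (b + 0)) + (a + (0 + (c + 0)) + (b + (c + (0 + 0)) + 0)) ≡ 2 * (a + b + c)
    tally = solve-∀

  record Path₃ (e : ℕ) : Set where
    field
      vertex    : Fin 3 → Fin (V G)
      injective : Injective _≡_ _≡_ vertex
      adj₀₁     : adj G (vertex 0F) (vertex 1F) ≡ true
      adj₁₂     : adj G (vertex 1F) (vertex 2F) ≡ true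
      arcs      : arcsWithin vertex ≡ e

  arcsWithin≤6 : ∀ (t : Fin 3 → Fin (V G)) → arcsWithin t ≤ 6
  arcsWithin≤6 t = ≤-trans (≤-reflexive (arcsWithin-triple t))
    (*-monoʳ-≤ 2 (+-mono-≤ (+-mono-≤ (⟦⟧≤1 (adj G (t 0F) (t 1F))) (⟦⟧≤1 (adj G (t 0F) (t 2F)))) (⟦⟧≤1 (adj G (t 1F) (t 2F)))))

  triangle⇒path₃ : HasTriangle G → Path₃ 6
  triangle⇒path₃ (u , v , w , uv , vw , wu) = record
    { vertex    = u ∷ v ∷ w ∷ []
    ; injective = triple-injective (adj⇒≢ uv) (adj⇒≢ (trans (adj-sym u w) wu)) (adj⇒≢ vw)
    ; adj₀₁     = uv
    ; adj₁₂     = vw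
    ; arcs      = trans (arcsWithin-triple (u ∷ v ∷ w ∷ [])) six
    }
    where
    six : 2 * (⟦ adj G u v ⟧ + ⟦ adj G u w ⟧ + ⟦ adj G v w ⟧) ≡ 6
    six rewrite uv | vw | trans (adj-sym u w) wu = refl

  triangle-free⇒arcsWithin≤4 : ¬ HasTriangle G → ∀ (t : Fin 3 → Fin (V G)) → arcsWithin t ≤ 4
  triangle-free⇒arcsWithin≤4 no-triangle t = ≤-trans (≤-reflexive (arcsWithin-triple t)) (*-monoʳ-≤ 2 at-most-two)
    where
    at-most-two : ⟦ adj G (t 0F) (t 1F) ⟧ + ⟦ adj G (t 0F) (t 2F) ⟧ + ⟦ adj G (t 1F) (t 2F) ⟧ ≤ 2
    at-most-two with adj G (t 0F) (t 1F) in a₀₁ | adj G (t 0F) (t 2F) in a₀₂ | adj G (t 1F) (t 2F) in a₁₂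
    ... | true  | true  | true  = ⊥-elim (no-triangle (t 0F , t 1F , t 2F , a₀₁ , a₁₂ , trans (adj-sym (t 2F) (t 0F)) a₀₂))
    ... | false | b     | c     = +-mono-≤ (⟦⟧≤1 b) (⟦⟧≤1 c)
    ... | true  | false | c     = s≤s (⟦⟧≤1 c)
    ... | true  | true  | false = ≤-refl

  triangle-free⇒path₃ : ¬ HasTriangle G → 2 ≤ k → Fin (V G) → Path₃ 4
  triangle-free⇒path₃ no-triangle 2≤k u
    with v , w , v≢w , uv , uw ← count>1⇒∃₂ (adj G u) (subst (1 <_) (sym (degree≡∑ u)) 2≤k) = record
    { vertex    = v ∷ u ∷ w ∷ []
    ; injective = triple-injective (adj⇒≢ vu) v≢w (adj⇒≢ uw)
    ; adj₀₁     = vu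
    ; adj₁₂     = uw
    ; arcs      = trans (arcsWithin-triple (v ∷ u ∷ w ∷ [])) four
    }
    where
    vu : adj G v u ≡ true
    vu = trans (adj-sym v u) uv
    vw : adj G v w ≡ false
    vw with adj G v w in a
    ... | false = refl
    ... | true  = ⊥-elim (no-triangle (v , u , w , vu , uw , trans (adj-sym w v) a))
    four : 2 * (⟦ adj G v u ⟧ + ⟦ adj G v w ⟧ + ⟦ adj G u w ⟧) ≡ 4
    four rewrite vu | vw | uw = refl

-- The direct product with the total graph

module Product (G : Graph) (k n : ℕ) (simple : IsSimple G) (regular : IsRegular G k) (3≤n : 3 ≤ n) where
  open RegularGraph G k simple regular

  X : Graph
  X = G ×ᵍ Total n

  π₁ : Fin (V X) → Fin (V G)
  π₁ x = proj₁ (remQuot {V G} n x)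

  π₂ : Fin (V X) → Fin n
  π₂ x = proj₂ (remQuot {V G} n x)

  ⟨_,_⟩ : Fin (V G) → Fin n → Fin (V X)
  ⟨ u , b ⟩ = combine u b

  π₁-⟨⟩ : ∀ u b → π₁ ⟨ u , b ⟩ ≡ u
  π₁-⟨⟩ u b = cong proj₁ (remQuot-combine u b)

  π₂-⟨⟩ : ∀ u b → π₂ ⟨ u , b ⟩ ≡ b
  π₂-⟨⟩ u b = cong proj₂ (remQuot-combine u b)

  ⟨π₁,π₂⟩ : ∀ x → ⟨ π₁ x , π₂ x ⟩ ≡ x
  ⟨π₁,π₂⟩ x = combine-remQuot {V G} n x

  ⟨⟩-injectiveˡ : ∀ {u b v c} → ⟨ u , b ⟩ ≡ ⟨ v , c ⟩ → u ≡ v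
  ⟨⟩-injectiveˡ {u} {b} {v} {c} eq = trans (sym (π₁-⟨⟩ u b)) (trans (cong π₁ eq) (π₁-⟨⟩ v c))

  ⟨⟩-injectiveʳ : ∀ {u b v c} → ⟨ u , b ⟩ ≡ ⟨ v , c ⟩ → b ≡ c
  ⟨⟩-injectiveʳ {u} {b} {v} {c} eq = trans (sym (π₂-⟨⟩ u b)) (trans (cong π₂ eq) (π₂-⟨⟩ v c))

  adjX : ∀ x y → adj X x y ≡ adj G (π₁ x) (π₁ y)
  adjX x y = ∧-identityʳ _

  adjX-⟨⟩ : ∀ u b v c → adj X ⟨ u , b ⟩ ⟨ v , c ⟩ ≡ adj G u v
  adjX-⟨⟩ u b v c = trans (adjX ⟨ u , b ⟩ ⟨ v , c ⟩) (cong₂ (adj G) (π₁-⟨⟩ u b) (π₁-⟨⟩ v c))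

  X-simple : IsSimple X
  X-simple = (λ x y → trans (adjX x y) (trans (adj-sym (π₁ x) (π₁ y)) (sym (adjX y x))))
           , (λ x → trans (adjX x x) (proj₂ simple (π₁ x)))

  module X = SimpleGraph X X-simple

  layer : Fin 3 → Fin n
  layer i = inject≤ i 3≤n

  layer-injective : Injective _≡_ _≡_ layer
  layer-injective = inject≤-injective 3≤n 3≤n _ _

  fibre : (Fin (V X) → Bool) → Fin (V G) → ℕ
  fibre B u = ∑[ b < n ] ⟦ B ⟨ u , b ⟩ ⟧

  fibre≤n : ∀ B u → fibre B u ≤ n
  fibre≤n B u = ≤-trans (∑-mono-≤ (λ b → ⟦⟧≤1 (B ⟨ u , b ⟩))) (≤-reflexive (trans (∑-const n 1) (*-identityʳ n)))

  fibre>0 : ∀ B {x} → B x ≡ true → 0 < fibre B (π₁ x)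
  fibre>0 B {x} Bx = ≤-trans (≤-reflexive (cong ⟦_⟧ (sym (trans (cong B (⟨π₁,π₂⟩ x)) Bx))))
                             (≤-∑ (λ b → ⟦ B ⟨ π₁ x , b ⟩ ⟧) (π₂ x))

  fibre-not<n : ∀ B u → 0 < fibre B u → fibre (not ∘ B) u < n
  fibre-not<n B u 0<a = subst (_< n) (sym (count-not (λ b → B ⟨ u , b ⟩))) (∸-monoʳ-< 0<a (fibre≤n B u))

  ∑-fibre : ∀ B → sum (fibre B) ≡ ∑[ x < V X ] ⟦ B x ⟧
  ∑-fibre B = sym (∑-combine (V G) n (λ x → ⟦ B x ⟧))

  ∑-π₁ : ∀ (f : Fin (V G) → ℕ) → ∑[ x < V X ] f (π₁ x) ≡ n * sum f
  ∑-π₁ f = begin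
    ∑[ x < V X ] f (π₁ x)               ≡⟨ ∑-combine (V G) n (f ∘ π₁) ⟩
    ∑[ u < V G ] ∑[ b < n ] f (π₁ ⟨ u , b ⟩) ≡⟨ sum-cong-≗ (λ u → trans (sum-cong-≗ λ b → cong f (π₁-⟨⟩ u b)) (∑-const n (f u))) ⟩
    ∑[ u < V G ] (n * f u)              ≡⟨ *-distribˡ-sum n f ⟨
    n * sum f                           ∎
    where open ≡-Reasoning

  twice-size-cutX : ∀ B → 2 * size (X.cut B) ≡ crossWeight n (fibre B)
  twice-size-cutX B = begin
    2 * size (X.cut B)
      ≡⟨ X.twice-size-cut B ⟩
    ∑[ x < V X ] ∑[ y < V X ] (⟦ adj X x y ⟧ * ⟦ B x xor B y ⟧)
      ≡⟨ ∑-combine (V G) n (λ x → ∑[ y < V X ] (⟦ adj X x y ⟧ * ⟦ B x xor B y ⟧)) ⟩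
    ∑[ u < V G ] ∑[ b < n ] ∑[ y < V X ] (⟦ adj X ⟨ u , b ⟩ y ⟧ * ⟦ B ⟨ u , b ⟩ xor B y ⟧)
      ≡⟨ sum-cong-≗ (λ u → sum-cong-≗ λ b → ∑-combine (V G) n (λ y → ⟦ adj X ⟨ u , b ⟩ y ⟧ * ⟦ B ⟨ u , b ⟩ xor B y ⟧)) ⟩
    ∑[ u < V G ] ∑[ b < n ] ∑[ v < V G ] ∑[ c < n ] (⟦ adj X ⟨ u , b ⟩ ⟨ v , c ⟩ ⟧ * ⟦ B ⟨ u , b ⟩ xor B ⟨ v , c ⟩ ⟧)
      ≡⟨ sum-cong-≗ (λ u → sum-cong-≗ λ b → sum-cong-≗ λ v → sum-cong-≗ λ c →
           cong (λ a → ⟦ a ⟧ * ⟦ B ⟨ u , b ⟩ xor B ⟨ v , c ⟩ ⟧) (adjX-⟨⟩ u b v c)) ⟩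
    ∑[ u < V G ] ∑[ b < n ] ∑[ v < V G ] ∑[ c < n ] (⟦ adj G u v ⟧ * ⟦ B ⟨ u , b ⟩ xor B ⟨ v , c ⟩ ⟧)
      ≡⟨ sum-cong-≗ (λ u → ∑-comm (λ b v → ∑[ c < n ] (⟦ adj G u v ⟧ * ⟦ B ⟨ u , b ⟩ xor B ⟨ v , c ⟩ ⟧))) ⟩
    ∑[ u < V G ] ∑[ v < V G ] ∑[ b < n ] ∑[ c < n ] (⟦ adj G u v ⟧ * ⟦ B ⟨ u , b ⟩ xor B ⟨ v , c ⟩ ⟧)
      ≡⟨ sum-cong-≗ (λ u → sum-cong-≗ λ v → factor u v) ⟩
    crossWeight n (fibre B)
      ∎
    where
    open ≡-Reasoning
    factor : ∀ u v → ∑[ b < n ] ∑[ c < n ] (⟦ adj G u v ⟧ * ⟦ B ⟨ u , b ⟩ xor B ⟨ v , c ⟩ ⟧)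
                   ≡ ⟦ adj G u v ⟧ * cross n (fibre B u) (fibre B v)
    factor u v = begin
      ∑[ b < n ] ∑[ c < n ] (⟦ adj G u v ⟧ * ⟦ B ⟨ u , b ⟩ xor B ⟨ v , c ⟩ ⟧)
        ≡⟨ sum-cong-≗ (λ b → *-distribˡ-sum ⟦ adj G u v ⟧ (λ c → ⟦ B ⟨ u , b ⟩ xor B ⟨ v , c ⟩ ⟧)) ⟨
      ∑[ b < n ] (⟦ adj G u v ⟧ * ∑[ c < n ] ⟦ B ⟨ u , b ⟩ xor B ⟨ v , c ⟩ ⟧)
        ≡⟨ *-distribˡ-sum ⟦ adj G u v ⟧ (λ b → ∑[ c < n ] ⟦ B ⟨ u , b ⟩ xor B ⟨ v , c ⟩ ⟧) ⟨
      ⟦ adj G u v ⟧ * ∑[ b < n ] ∑[ c < n ] ⟦ B ⟨ u , b ⟩ xor B ⟨ v , c ⟩ ⟧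
        ≡⟨ cong (⟦ adj G u v ⟧ *_) (∑∑-xor n (λ b → B ⟨ u , b ⟩) (λ c → B ⟨ v , c ⟩)) ⟩
      ⟦ adj G u v ⟧ * cross n (fibre B u) (fibre B v)
        ∎

  crossWeight≤2*size : ∀ S {B} → ClosedUnder (minus X S) B → crossWeight n (fibre B) ≤ 2 * size S
  crossWeight≤2*size S {B} B-closed = subst (_≤ 2 * size S) (twice-size-cutX B) (*-monoʳ-≤ 2 (X.size-cut≤ S B B-closed))

  module _ (2≤k : 2 ≤ k) {e : ℕ} (4≤e : 4 ≤ e) (arcs≤e : ∀ (t : Fin 3 → Fin (V G)) → arcsWithin t ≤ e) where

    edge-side-bound : ∀ {B x y} → adj X x y ≡ true → B x ≡ true → B y ≡ true →
      3 ≤ sum (fibre B) → (∀ u → fibre B u < n) → 2 * (k * (n * 3)) ≤ crossWeight n (fibre B) + 2 * e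
    edge-side-bound {B} {x} {y} xy Bx By 3≤∑a a<n =
      by-cases (any? λ v → ¬? (v ≟ π₁ x) ×-dec ¬? (v ≟ π₁ y) ×-dec (0 <? a v))
      where
      a : Fin (V G) → ℕ
      a = fibre B
      uw : adj G (π₁ x) (π₁ y) ≡ true
      uw = trans (sym (adjX x y)) xy
      mixed-x : Mixed n (a (π₁ x))
      mixed-x = fibre>0 B Bx , a<n (π₁ x)
      mixed-y : Mixed n (a (π₁ y))
      mixed-y = fibre>0 B By , a<n (π₁ y)
      by-cases : Dec (∃ λ v → v ≢ π₁ x × v ≢ π₁ y × 0 < a v) → 2 * (k * (n * 3)) ≤ crossWeight n a + 2 * e
      by-cases (yes (v , v≢u , v≢w , 0<av)) =
        ≤-trans (mixed-fibres-bound (triple-injective (adj⇒≢ uw) (v≢u ∘ sym) (v≢w ∘ sym)) a (fibre≤n B)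
                                    λ { 0F → mixed-x ; 1F → mixed-y ; 2F → 0<av , a<n v })
                (+-monoʳ-≤ (crossWeight n a) (*-monoʳ-≤ 2 (arcs≤e (π₁ x ∷ π₁ y ∷ v ∷ []))))
      by-cases (no ¬third) =
        ≤-trans (two-mixed-fibres-bound a uw (λ v v≢u v≢w → n≤0⇒n≡0 (≮⇒≥ λ 0<av → ¬third (v , v≢u , v≢w , 0<av)))
                                        (fibre≤n B) mixed-x mixed-y 3≤∑a 2≤k)
                (+-monoʳ-≤ (crossWeight n a) (*-monoʳ-≤ 2 4≤e))

    side-bound : ∀ {S B x} → IsRestrictedCut X 3 S → ClosedUnder (minus X S) B → B x ≡ true →
                 (∀ u → fibre B u < n) → 3 * n * k ≤ size S + e
    side-bound {S} {B} {x} R B-closed Bx a<n with y , xy ← X.restricted⇒neighbour {S = S} R x =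
      *-cancelˡ-≤ 2 (begin
        2 * (3 * n * k)                      ≡⟨ regroup n k ⟩
        2 * (k * (n * 3))                    ≤⟨ edge-side-bound (∧-true-left xy) Bx (trans (sym (B-closed x y xy)) Bx) 3≤∑a a<n ⟩
        crossWeight n (fibre B) + 2 * e      ≤⟨ +-monoˡ-≤ (2 * e) (crossWeight≤2*size S B-closed) ⟩
        2 * size S + 2 * e                   ≡⟨ *-distribˡ-+ 2 (size S) e ⟨
        2 * (size S + e)                     ∎)
      where
      open ≤-Reasoning
      3≤∑a : 3 ≤ sum (fibre B)
      3≤∑a = subst (3 ≤_) (sym (∑-fibre B)) (X.restricted⇒≤count {S = S} R B-closed Bx)
      regroup : ∀ n k → 2 * (3 * n * k) ≡ 2 * (k * (n * 3))
      regroup = solve-∀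

    lower-bound : ∀ {l2} → LambdaIs G 2 l2 → ∀ S → IsRestrictedCut X 3 S →
                  n * n * λ₂⊓k l2 ≤ size S ⊎ 3 * n * k ≤ size S + e
    lower-bound {l2} λ₂ S R =
      decidable-stable (n * n * λ₂⊓k l2 ≤? size S ⊎-dec 3 * n * k ≤? size S + e)
                       (¬¬-map from-separation (¬¬-separation (X.minus-sym S) (proj₁ R)))
      where
      from-separation : Separation (minus X S) → n * n * λ₂⊓k l2 ≤ size S ⊎ 3 * n * k ≤ size S + e
      from-separation (B , B-closed , (x , Bx) , (y , By)) with any? (λ u → fibre B u ≟ℕ n)
      ... | no ¬full = inj₂ (side-bound {S} R B-closed Bx λ u → ≤∧≢⇒< (fibre≤n B u) λ full → ¬full (u , full))
      ... | yes (p , full) with any? (λ z → fibre B z ≟ℕ 0)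
      ...   | yes (z , empty) = inj₁ (*-cancelˡ-≤ 2 (begin
              2 * (n * n * λ₂⊓k l2)     ≡⟨ cong (2 *_) (*-assoc n n (λ₂⊓k l2)) ⟩
              2 * (n * (n * λ₂⊓k l2))   ≤⟨ full-and-empty-fibres-bound λ₂ (fibre B) (fibre≤n B) full empty ⟩
              crossWeight n (fibre B)   ≤⟨ crossWeight≤2*size S B-closed ⟩
              2 * size S                ∎))
        where open ≤-Reasoning
      ...   | no ¬empty = inj₂ (side-bound {S} R (λ u v uv → cong not (B-closed u v uv)) (cong not By)
                                  λ u → fibre-not<n B u (n≢0⇒n>0 λ empty → ¬empty (u , empty)))

  lift : EdgeSet G → EdgeSet X
  lift SG = record
    { mem    = λ x y → mem SG (π₁ x) (π₁ y)
    ; symm   = λ x y → symm SG (π₁ x) (π₁ y)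
    ; subset = λ x y xy∈S → trans (adjX x y) (subset SG (π₁ x) (π₁ y) xy∈S)
    }

  size-lift : ∀ SG → size (lift SG) ≡ n * n * size SG
  size-lift SG = *-cancelˡ-≡ _ _ 2 (begin
    2 * size (lift SG)                                       ≡⟨ twice-size (lift SG) (λ x → mem-irrefl SG (π₁ x)) ⟩
    ∑[ x < V X ] ∑[ y < V X ] ⟦ mem SG (π₁ x) (π₁ y) ⟧        ≡⟨ sum-cong-≗ (λ x → ∑-π₁ (λ v → ⟦ mem SG (π₁ x) v ⟧)) ⟩
    ∑[ x < V X ] (n * ∑[ v < V G ] ⟦ mem SG (π₁ x) v ⟧)       ≡⟨ ∑-π₁ (λ u → n * ∑[ v < V G ] ⟦ mem SG u v ⟧) ⟩
    n * ∑[ u < V G ] (n * ∑[ v < V G ] ⟦ mem SG u v ⟧)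
      ≡⟨ cong (n *_) (*-distribˡ-sum n (λ u → ∑[ v < V G ] ⟦ mem SG u v ⟧)) ⟨
    n * (n * ∑∑ (λ u v → ⟦ mem SG u v ⟧))
      ≡⟨ cong (λ s → n * (n * s)) (twice-size SG (mem-irrefl SG)) ⟨
    n * (n * (2 * size SG))                                   ≡⟨ regroup n (size SG) ⟩
    2 * (n * n * size SG)                                     ∎)
    where
    open ≡-Reasoning
    regroup : ∀ n s → n * (n * (2 * s)) ≡ 2 * (n * n * s)
    regroup = solve-∀

  minus-lift : ∀ SG x y → minus X (lift SG) x y ≡ minus G SG (π₁ x) (π₁ y)
  minus-lift SG x y = cong (_∧ not (mem SG (π₁ x) (π₁ y))) (adjX x y)

  lift-restricted : ∀ SG → IsRestrictedCut G 2 SG → IsRestrictedCut X 3 (lift SG)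
  lift-restricted SG R@(G-SG-disconnected , _) = disconnected , component
    where
    disconnected : ¬ ConnectedRel (minus X (lift SG))
    disconnected connected = G-SG-disconnected λ u v →
      subst₂ (Reach (minus G SG)) (π₁-⟨⟩ u (layer 0F)) (π₁-⟨⟩ v (layer 0F))
        (reach-map π₁ (λ x y xy → trans (sym (minus-lift SG x y)) xy) (connected ⟨ u , layer 0F ⟩ ⟨ v , layer 0F ⟩))
    component : ∀ x → Σ (Fin 3 → Fin (V X)) λ f → Injective _≡_ _≡_ f × (∀ i → Reach (minus X (lift SG)) x (f i))
    component x with v , uv ← restricted⇒neighbour {S = SG} R (π₁ x) =
      (λ i → ⟨ v , layer i ⟩) ,
      (λ eq → layer-injective (⟨⟩-injectiveʳ eq)) ,
      λ i → step (trans (minus-lift SG x ⟨ v , layer i ⟩) (trans (cong (minus G SG (π₁ x)) (π₁-⟨⟩ v (layer i))) uv)) here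

  star : ∀ {j} → (Fin j → Fin (V G)) → Fin (V X) → Bool
  star t x = does (image? t (π₁ x)) ∧ does (π₂ x ≟ layer 0F)

  fibre-star : ∀ {j} (t : Fin j → Fin (V G)) u → fibre (star t) u ≡ ⟦ does (image? t u) ⟧
  fibre-star t u = begin
    ∑[ b < n ] ⟦ star t ⟨ u , b ⟩ ⟧            ≡⟨ sum-cong-≗ layer-term ⟩
    ∑[ b < n ] (τ * δ b (layer 0F))           ≡⟨ *-distribˡ-sum τ (λ b → δ b (layer 0F)) ⟨
    τ * ∑[ b < n ] δ b (layer 0F)             ≡⟨ cong (τ *_) (∑-δˡ (layer 0F)) ⟩
    τ * 1                                     ≡⟨ *-identityʳ τ ⟩
    τ                                         ∎
    where
    open ≡-Reasoning
    τ : ℕ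
    τ = ⟦ does (image? t u) ⟧
    layer-term : ∀ b → ⟦ star t ⟨ u , b ⟩ ⟧ ≡ τ * δ b (layer 0F)
    layer-term b = trans (⟦∧⟧ (does (image? t (π₁ ⟨ u , b ⟩))) (does (π₂ ⟨ u , b ⟩ ≟ layer 0F)))
                         (cong₂ (λ v c → ⟦ does (image? t v) ⟧ * δ c (layer 0F)) (π₁-⟨⟩ u b) (π₂-⟨⟩ u b))

  size-star-cut : ∀ {j} {t : Fin j → Fin (V G)} → Injective _≡_ _≡_ t →
                  size (X.cut (star t)) + arcsWithin t ≡ k * (n * j)
  size-star-cut {j} {t} t-inj = *-cancelˡ-≡ _ _ 2 (begin
    2 * (size (X.cut (star t)) + arcsWithin t)                 ≡⟨ *-distribˡ-+ 2 (size (X.cut (star t))) (arcsWithin t) ⟩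
    2 * size (X.cut (star t)) + 2 * arcsWithin t
      ≡⟨ cong₂ (λ c a → c + 2 * a) (twice-size-cutX (star t)) (sym (arcSum-image t-inj)) ⟩
    crossWeight n (fibre (star t)) + 2 * arcSum (λ u v → τ u * τ v)
                                                               ≡⟨ cong (λ c → c + 2 * arcSum (λ u v → τ u * τ v))
                                                                       (arcSum-cong λ u v _ → cong₂ (cross n) (fibre-star t u) (fibre-star t v)) ⟩
    crossWeight n τ + 2 * arcSum (λ u v → τ u * τ v)
      ≡⟨ crossWeight-identity τ (λ u → ≤-trans (⟦⟧≤1 _) (≤-trans (s≤s z≤n) 3≤n)) ⟩
    2 * (k * (n * sum τ))                                      ≡⟨ cong (λ s → 2 * (k * (n * s))) (∑-⟦image⟧ t-inj) ⟩
    2 * (k * (n * j))                                          ∎)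
    where
    open ≡-Reasoning
    τ : Fin (V G) → ℕ
    τ u = ⟦ does (image? t u) ⟧

  star-restricted : ∀ {e} → 0 < k → (P : Path₃ e) → IsRestrictedCut X 3 (X.cut (star (Path₃.vertex P)))
  star-restricted 0<k P = X.cut-disconnects W (in-W 0F) (off-W (t 0F) 1≢0) , component
    where
    open Path₃ P renaming (vertex to t)
    W : Fin (V X) → Bool
    W = star t
    M : Fin (V X) → Fin (V X) → Bool
    M = minus X (X.cut W)
    Component : Fin (V X) → Set
    Component x = Σ (Fin 3 → Fin (V X)) λ f → Injective _≡_ _≡_ f × (∀ i → Reach M x (f i))

    1≢0 : layer 1F ≢ layer 0F
    1≢0 eq with () ← layer-injective eq
    2≢0 : layer 2F ≢ layer 0F
    2≢0 eq with () ← layer-injective eq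

    in-W : ∀ i → W ⟨ t i , layer 0F ⟩ ≡ true
    in-W i = cong₂ _∧_
      (trans (cong (λ v → does (image? t v)) (π₁-⟨⟩ (t i) (layer 0F))) (dec-true (image? t (t i)) (i , refl)))
      (trans (cong (λ c → does (c ≟ layer 0F)) (π₂-⟨⟩ (t i) (layer 0F))) (dec-true (layer 0F ≟ layer 0F) refl))

    off-W : ∀ v {c} → c ≢ layer 0F → W ⟨ v , c ⟩ ≡ false
    off-W v {c} c≢0 = trans (cong (does (image? t (π₁ ⟨ v , c ⟩)) ∧_)
                                  (trans (cong (λ c′ → does (c′ ≟ layer 0F)) (π₂-⟨⟩ v c)) (dec-false (c ≟ layer 0F) c≢0)))
                            (∧-zeroʳ _)

    position : ∀ x → (∃ λ i → x ≡ ⟨ t i , layer 0F ⟩) ⊎ W x ≡ false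
    position x = classify (image? t (π₁ x)) (π₂ x ≟ layer 0F) refl
      where
      classify : (d₁ : Dec (∃ λ i → t i ≡ π₁ x)) (d₂ : Dec (π₂ x ≡ layer 0F)) → W x ≡ does d₁ ∧ does d₂ →
                 (∃ λ i → x ≡ ⟨ t i , layer 0F ⟩) ⊎ W x ≡ false
      classify (yes (i , tᵢ≡)) (yes b≡) _  = inj₁ (i , trans (sym (⟨π₁,π₂⟩ x)) (cong₂ ⟨_,_⟩ (sym tᵢ≡) b≡))
      classify (yes _)         (no _)   Wx = inj₂ Wx
      classify (no _)          _        Wx = inj₂ Wx

    path-step : ∀ i i′ → adj G (t i) (t i′) ≡ true → M ⟨ t i , layer 0F ⟩ ⟨ t i′ , layer 0F ⟩ ≡ true
    path-step i i′ tt′ =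
      X.minus-cut W (trans (adjX-⟨⟩ (t i) (layer 0F) (t i′) (layer 0F)) tt′) (trans (in-W i) (sym (in-W i′)))

    from-middle : ∀ i → Reach M ⟨ t 1F , layer 0F ⟩ ⟨ t i , layer 0F ⟩
    from-middle 0F = step (path-step 1F 0F (trans (adj-sym (t 1F) (t 0F)) adj₀₁)) here
    from-middle 1F = here
    from-middle 2F = step (path-step 1F 2F adj₁₂) here

    inside : ∀ i → Component ⟨ t i , layer 0F ⟩
    inside i = (λ i′ → ⟨ t i′ , layer 0F ⟩)
             , (λ eq → injective (⟨⟩-injectiveˡ eq))
             , λ i′ → reach-++ (reach-sym (X.minus-sym (X.cut W)) (from-middle i)) (from-middle i′)

    outside : ∀ x → W x ≡ false → Component x
    outside x Wx with v , uv ← neighbour 0<k (π₁ x) =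
      (x ∷ ⟨ v , layer 1F ⟩ ∷ ⟨ v , layer 2F ⟩ ∷ []) ,
      triple-injective x≢v x≢v (λ eq → 1≢2 (layer-injective (⟨⟩-injectiveʳ eq))) ,
      λ { 0F → here ; 1F → step (edge 1≢0) here ; 2F → step (edge 2≢0) here }
      where
      1≢2 : 1F ≢ 2F
      1≢2 ()
      x≢v : ∀ {c} → x ≢ ⟨ v , c ⟩
      x≢v {c} eq = adj⇒≢ uv (trans (cong π₁ eq) (π₁-⟨⟩ v c))
      edge : ∀ {c} → c ≢ layer 0F → M x ⟨ v , c ⟩ ≡ true
      edge {c} c≢0 = X.minus-cut W (trans (adjX x ⟨ v , c ⟩) (trans (cong (adj G (π₁ x)) (π₁-⟨⟩ v c)) uv))
                                   (trans Wx (sym (off-W v c≢0)))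

    component : ∀ x → Component x
    component x with position x
    ... | inj₁ (i , refl) = inside i
    ... | inj₂ Wx         = outside x Wx

  λ₃-product : 2 ≤ k → ∀ {l2} → LambdaIs G 2 l2 →
               ∀ {e} → 4 ≤ e → (∀ (t : Fin 3 → Fin (V G)) → arcsWithin t ≤ e) → Path₃ e →
               LambdaIs X 3 (just (maybe (λ c → (n * n * c) ⊓ (3 * n * k ∸ e)) (3 * n * k ∸ e) l2))
  λ₃-product 2≤k {l2} λ₂ {e} 4≤e arcs≤e P =
    optimal-cut l2 λ₂ , λ S R → minimality {S} (lower-bound 2≤k 4≤e arcs≤e λ₂ S R)
    where
    T : ℕ
    T = 3 * n * k ∸ e
    bound : Maybe ℕ → ℕ
    bound = maybe (λ c → (n * n * c) ⊓ T) T

    star-cut : EdgeSet X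
    star-cut = X.cut (star (Path₃.vertex P))

    size-star-cut≡T : size star-cut ≡ T
    size-star-cut≡T = begin
      size star-cut                                       ≡⟨ m+n∸n≡m (size star-cut) e ⟨
      size star-cut + e ∸ e                               ≡⟨ cong (λ a → size star-cut + a ∸ e) (Path₃.arcs P) ⟨
      size star-cut + arcsWithin (Path₃.vertex P) ∸ e     ≡⟨ cong (_∸ e) (size-star-cut (Path₃.injective P)) ⟩
      k * (n * 3) ∸ e                                     ≡⟨ cong (_∸ e) (regroup k n) ⟩
      T                                                   ∎
      where
      open ≡-Reasoning
      regroup : ∀ k n → k * (n * 3) ≡ 3 * n * k
      regroup = solve-∀

    star-cut-restricted : IsRestrictedCut X 3 star-cut
    star-cut-restricted = star-restricted (≤-trans (s≤s z≤n) 2≤k) P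

    optimal-cut : ∀ l2 → LambdaIs G 2 l2 → Σ (EdgeSet X) λ S → IsRestrictedCut X 3 S × size S ≡ bound l2
    optimal-cut nothing _ = star-cut , star-cut-restricted , size-star-cut≡T
    optimal-cut (just c) ((SG , SG-restricted , size-SG) , _) with n * n * c ≤? T
    ... | yes ≤T = lift SG , lift-restricted SG SG-restricted
                 , trans (size-lift SG) (trans (cong (n * n *_) size-SG) (sym (m≤n⇒m⊓n≡m ≤T)))
    ... | no  ≰T = star-cut , star-cut-restricted , trans size-star-cut≡T (sym (m≥n⇒m⊓n≡n (<⇒≤ (≰⇒> ≰T))))

    T≤n*n*k : T ≤ n * n * k
    T≤n*n*k = ≤-trans (m∸n≤m (3 * n * k) e) (*-monoˡ-≤ k (*-monoˡ-≤ n 3≤n))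

    bound≤n*n*λ₂⊓k : ∀ l2 → bound l2 ≤ n * n * λ₂⊓k l2
    bound≤n*n*λ₂⊓k nothing  = T≤n*n*k
    bound≤n*n*λ₂⊓k (just c) = ≤-trans (⊓-monoʳ-≤ (n * n * c) T≤n*n*k) (≤-reflexive (sym (*-distribˡ-⊓ (n * n) c k)))

    bound≤T : ∀ l2 → bound l2 ≤ T
    bound≤T nothing  = ≤-refl
    bound≤T (just c) = m⊓n≤n (n * n * c) T

    minimality : ∀ {S} → n * n * λ₂⊓k l2 ≤ size S ⊎ 3 * n * k ≤ size S + e → bound l2 ≤ size S
    minimality     (inj₁ ≤S)   = ≤-trans (bound≤n*n*λ₂⊓k l2) ≤S
    minimality {S} (inj₂ ≤S+e) =
      ≤-trans (bound≤T l2) (m≤n+o⇒m∸n≤o (3 * n * k) e (subst (3 * n * k ≤_) (+-comm (size S) e) ≤S+e))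

theorem3p3 : (G : Graph) (k n : ℕ) → IsSimple G → IsConnected G → IsRegular G k →
    2 ≤ k → 4 ≤ V G → 3 ≤ n → (l2 : Maybe ℕ) → LambdaIs G 2 l2 →
    (Girth3 G → LambdaIs (G ×ᵍ Total n) 3
        (just (maybe (λ c → (n * n * c) ⊓ (3 * n * k ∸ 6)) (3 * n * k ∸ 6) l2))) ×
    (GirthAtLeast4 G → LambdaIs (G ×ᵍ Total n) 3
        (just (maybe (λ c → (n * n * c) ⊓ (3 * n * k ∸ 4)) (3 * n * k ∸ 4) l2)))
theorem3p3 G k n simple _ regular 2≤k 4≤|G| 3≤n l2 λ₂ =
    (λ triangle → λ₃-product 2≤k λ₂ (m≤m+n 4 2) arcsWithin≤6 (triangle⇒path₃ triangle))
  , (λ no-triangle → λ₃-product 2≤k λ₂ ≤-refl (triangle-free⇒arcsWithin≤4 no-triangle)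
                                (triangle-free⇒path₃ no-triangle 2≤k (fromℕ< (≤-trans (s≤s z≤n) 4≤|G|))))
  where
  open RegularGraph G k simple regular
  open Product G k n simple regular 3≤n
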